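{- For every positive integer $k$, as formal power series in $q$, \[ \sum_{n=1}^{\infty}\overline{\mathrm{spt}}k_o'(n)\,q^n=\overline{T}_{k}(q)\frac{(q;q^2)_{\infty}}{(-q;q^2)_{\infty}}+2q^k\frac{(q^2;q^2)_{k-1}}{(-q^2;q^2)_{k}}, \] where the rational functions $\overline{T}_k$ are defined by $\overline{T}_1(q)=-\frac{q(1+q)}{1+q^2}$ and, for $k>1$, \[ \overline{T}_{k}(q)=\frac{(q-q^{2k-1})\overline{T}_{k-1}(q)-q^{2k-1}(1+q)}{1+q^{2k}}. \]
   Context: Notation: $(a;q^2)_N=\prod_{j=0}^{N-1}(1-aq^{2j})$ (with $(a;q^2)_0=1$) and $(a;q^2)_\infty=\prod_{j\ge 0}(1-aq^{2j})$. An overpartition of $n$ is a partition of $n$ in which the first occurrence of each distinct part size may be overlined. For an overpartition $\pi$, $s(\pi)$ denotes its smallest non-overlined part. For a positive integer $k$, let $\overline{\mathrm{Spt}}k_o(n)$ be the set of overpartitions $\pi$ of $n$ having at least one non-overlined part, such that $s(\pi)$ appears exactly $k$ times, every overlined part is strictly bigger than $s(\pi)$, and every part other than (the copies of) $s(\pi)$ has parity different from that of $s(\pi)$. Let $b_e(k,n)$ (resp. $b_o(k,n)$) be the number of $\pi\in\overline{\mathrm{Spt}}k_o(n)$ for which the number of parts (counted with multiplicity) greater than $s(\pi)$ is even (resp. odd), and $\overline{\mathrm{spt}}k_o'(n)=b_e(k,n)-b_o(k,n)$. (Equivalently, $\sum_{n\ge1}\overline{\mathrm{spt}}k_o'(n)q^n=\sum_{n\ge1}q^{kn}\frac{(q^{n+1};q^2)_\infty}{(-q^{n+1};q^2)_\infty}$.)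 -}

module Defs where

open import Data.Nat as ℕ using (ℕ; zero; suc; _∸_; _≡ᵇ_; _<ᵇ_; _%_)
open import Data.Integer as ℤ using (ℤ; +_; -_)
open import Data.Bool using (Bool; true; false; _∧_; _∨_; not; if_then_else_)
open import Data.List using (List; []; _∷_; map; concatMap; foldr; upTo; filterᵇ; length)
open import Data.Maybe using (Maybe; just; nothing)
open import Data.Product using (_×_; _,_; proj₁; proj₂)

-- A part is (size , overlined?).
Part : Set
Part = ℕ × Bool

allᵇ : {A : Set} → (A → Bool) → List A → Bool
allᵇ p = foldr (λ x acc → p x ∧ acc) true

-- Canonical list representation of an overpartition: parts listed in
-- non-increasing order of size; within a block of equal sizes only the
-- FIRST element may be overlined (the "first occurrence" of the size).
chainOK : List Part → Bool
chainOK [] = true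
chainOK (_ ∷ []) = true
chainOK ((a , x) ∷ (b , y) ∷ rest) =
  ((b <ᵇ a) ∨ ((a ≡ᵇ b) ∧ not y)) ∧ chainOK ((b , y) ∷ rest)

sizeSum : List Part → ℕ
sizeSum = foldr (λ p acc → proj₁ p ℕ.+ acc) 0

isOverpartition : ℕ → List Part → Bool
isOverpartition n π =
  allᵇ (λ p → 0 <ᵇ proj₁ p) π ∧ (sizeSum π ≡ᵇ n) ∧ chainOK π

minMaybe : ℕ → Maybe ℕ → Maybe ℕ
minMaybe a nothing = just a
minMaybe a (just b) = just (ℕ._⊓_ a b)

smallestNonOverlined : List Part → Maybe ℕ
smallestNonOverlined [] = nothing
smallestNonOverlined ((a , true) ∷ π) = smallestNonOverlined π
smallestNonOverlined ((a , false) ∷ π) = minMaybe a (smallestNonOverlined π)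

sameParity : ℕ → ℕ → Bool
sameParity a b = (a % 2) ≡ᵇ (b % 2)

inSptko : ℕ → List Part → Bool
inSptko k π with smallestNonOverlined π
... | nothing = false
... | just s =
  (length (filterᵇ (λ p → proj₁ p ≡ᵇ s) π) ≡ᵇ k)
  ∧ allᵇ (λ p → if proj₂ p then s <ᵇ proj₁ p else true) π
  ∧ allᵇ (λ p → (proj₁ p ≡ᵇ s) ∨ not (sameParity (proj₁ p) s)) π

partsAboveS : List Part → ℕ
partsAboveS π with smallestNonOverlined π
... | nothing = 0
... | just s = length (filterᵇ (λ p → s <ᵇ proj₁ p) π)

signOf : ℕ → ℤ
signOf m = if (m % 2) ≡ᵇ 0 then + 1 else - (+ 1)

listsUpTo : {A : Set} → ℕ → List A → List (List A)
listsUpTo zero alph = [] ∷ []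
listsUpTo (suc L) alph = [] ∷ concatMap (λ a → map (a ∷_) (listsUpTo L alph)) alph

alphabet : ℕ → List Part
alphabet n = concatMap (λ a → (a , false) ∷ (a , true) ∷ []) (upTo (suc n))

-- Every overpartition of n has at most n parts, each of size ≤ n.
candidates : ℕ → List (List Part)
candidates n = listsUpTo n (alphabet n)

sumℤ : List ℤ → ℤ
sumℤ = foldr ℤ._+_ (+ 0)

spt′ko : ℕ → ℕ → ℤ
spt′ko k n =
  sumℤ (map (λ π → if isOverpartition n π ∧ inSptko k π
                    then signOf (partsAboveS π) else + 0)
            (candidates n))

Series : Set
Series = ℕ → ℤ

Σ≤ : ℕ → (ℕ → ℤ) → ℤ
Σ≤ n f = sumℤ (map f (upTo (suc n)))

_⊕_ : Series → Series → Series
(f ⊕ g) n = f n ℤ.+ g n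

⊖_ : Series → Series
(⊖ f) n = - f n

_⊛_ : Series → Series → Series
(f ⊛ g) n = Σ≤ n (λ i → f i ℤ.* g (n ∸ i))

infixl 6 _⊕_
infixl 7 _⊛_

constS : ℤ → Series
constS c zero = c
constS c (suc _) = + 0

mono : ℤ → ℕ → Series
mono c m n = if n ≡ᵇ m then c else + 0

oneS : Series
oneS = constS (+ 1)

-- Multiplicative inverse of a series f with f 0 = 1 (the only case used):
-- g 0 = 1,  g n = - Σ_{i=1}^{n} f i · g (n - i).
invStep : Series → ℕ → (ℕ → ℤ)
invStep f zero m = if m ≡ᵇ 0 then + 1 else + 0
invStep f (suc n) m =
  if m ≡ᵇ suc n
  then - Σ≤ n (λ j → f (suc j) ℤ.* invStep f n (n ∸ j))
  else invStep f n m

inv : Series → Series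
inv f n = invStep f n n

factor : ℤ → ℕ → Series
factor a e = oneS ⊕ mono (- a) e

poch : ℤ → ℕ → ℕ → Series
poch a m zero = oneS
poch a m (suc N) = poch a m N ⊛ factor a (m ℕ.+ 2 ℕ.* N)

-- (a q^m ; q^2)_∞ for m ≥ 1: the coefficient of q^n is already determined
-- by the first n+1 factors (all later factors are 1 + O(q^{n+1})).
pochInf : ℤ → ℕ → Series
pochInf a m n = poch a m (suc n) n

-- \overline{T}_k as a power series (its denominators have constant term 1).
-- Index 0 is unused (dummy value 0).
Tbar : ℕ → Series
Tbar zero = constS (+ 0)
Tbar (suc zero) = ⊖ ((mono (+ 1) 1 ⊕ mono (+ 1) 2) ⊛ inv (oneS ⊕ mono (+ 1) 2))
Tbar (suc (suc k)) =
  ((mono (+ 1) 1 ⊕ mono (- (+ 1)) (2 ℕ.* k ℕ.+ 3)) ⊛ Tbar (suc k)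
     ⊕ ⊖ (mono (+ 1) (2 ℕ.* k ℕ.+ 3) ⊛ (oneS ⊕ mono (+ 1) 1)))
  ⊛ inv (oneS ⊕ mono (+ 1) (2 ℕ.* k ℕ.+ 4))

sptGF : ℕ → Series
sptGF k zero = + 0
sptGF k (suc n) = spt′ko k (suc n)

rhs : ℕ → Series
rhs k =
  Tbar k ⊛ pochInf (+ 1) 1 ⊛ inv (pochInf (- (+ 1)) 1)
  ⊕ mono (+ 2) k ⊛ poch (+ 1) 2 (k ∸ 1) ⊛ inv (poch (- (+ 1)) 2 k)

-- Grouping the overpartitions by s = s(π): such a π is k non-overlined copies of s below parts
-- b > s of the other parity, each size occurring at most once overlined and any number of times
-- non-overlined, and each part above s contributes a sign -1.  Hence
-- Σₙ spt'k_o(n) qⁿ = G_k with G_j = Σ_{s≥1} q^{js} a_s and a_s = (q^{s+1};q²)_∞ / (-q^{s+1};q²)_∞.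
-- Multiplying (1 + q^{s+1}) a_s = (1 - q^{s+1}) a_{s+2} by q^{1+j(s+2)} and summing over s telescopes to
--   (1 + q^{2j+2}) G_{j+1} = (q - q^{2j+1}) G_j - q^{2j+1} (1 + q) a_0 + (boundary terms),
-- using (1 - q) a_2 = (1 + q) a_0.  The boundary terms vanish for j ≥ 1 and tend to 2q for j = 0, so
-- G_k obeys the recursion defining T̄_k; so does the right-hand side, and 1 + q^{2k} is invertible.
--
-- Infinite sums and products are reached through truncations: series are compared up to a degree t,
-- a_s is replaced by a finite product, and the finite enumeration defining spt'k_o is evaluated by
-- reading each candidate list from its largest part on.

module Submission where

open import Defs
open import Data.Nat using (ℕ; _≤_)
open import Relation.Binary.PropositionalEquality using (_≡_)

open import Algebra.Bundles using (CommutativeRing)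
import Algebra.Solver.CommutativeMonoid as CMSolver
import Algebra.Solver.Ring.AlmostCommutativeRing as ACR
import Data.Bool.Properties as BoolP
open import Data.Bool.Base using (Bool; true; false; if_then_else_; _∧_; _∨_; not)
open import Data.Empty using (⊥-elim)
open import Data.Integer.Base as ℤ using (ℤ; 0ℤ; 1ℤ; -_; _+_; _*_)
import Data.Integer.Properties as ℤP
open import Data.Integer.Tactic.RingSolver using (solve-∀)
open import Data.List.Base using (List; []; _∷_; map; applyUpTo; upTo; _++_; concatMap; length; filterᵇ)
import Data.List.Properties as ListP
open import Data.Maybe.Base using (Maybe; just; nothing)
open import Data.Nat.Base as ℕ using (zero; suc; _∸_; _<_; z≤n; s≤s; _≡ᵇ_; _<ᵇ_; _≤ᵇ_; _%_)
import Data.Nat.Properties as ℕP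
import Data.Nat.Tactic.RingSolver as ℕSolver
open import Data.Product.Base using (_,_; proj₁; proj₂)
open import Data.Sum.Base using (inj₁; inj₂)
open import Function.Base using (_∘_; case_of_)
open import Level using (0ℓ)
open import Relation.Binary.Bundles using (Setoid)
open import Relation.Binary.Definitions using (tri<; tri≈; tri>)
open import Relation.Binary.PropositionalEquality
import Relation.Binary.Reasoning.Setoid as SetoidReasoning
open import Relation.Nullary.Decidable.Core using (Dec; yes; no)
open import Relation.Nullary.Negation.Core using (¬_)
open import Relation.Nullary.Reflects using (Reflects; ofʸ; ofⁿ; fromEquivalence)
open import Algebra.Properties.CommutativeSemigroup ℤP.+-commutativeSemigroup using (interchange)

𝟙 : Bool → ℤ
𝟙 b = if b then 1ℤ else 0ℤ

≡ᵇ-reflects-≡ : ∀ m n → Reflects (m ≡ n) (m ≡ᵇ n)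
≡ᵇ-reflects-≡ m n = fromEquivalence (ℕP.≡ᵇ⇒≡ m n) (ℕP.≡⇒≡ᵇ m n)

≡ᵇ-refl : ∀ n → (n ≡ᵇ n) ≡ true
≡ᵇ-refl zero = refl
≡ᵇ-refl (suc n) = ≡ᵇ-refl n

≡ᵇ-sym : ∀ m n → (m ≡ᵇ n) ≡ (n ≡ᵇ m)
≡ᵇ-sym zero zero = refl
≡ᵇ-sym zero (suc n) = refl
≡ᵇ-sym (suc m) zero = refl
≡ᵇ-sym (suc m) (suc n) = ≡ᵇ-sym m n

if-∧ : ∀ {A : Set} c d (x z : A) → (if c ∧ d then x else z) ≡ (if c then (if d then x else z) else z)
if-∧ true d x z = refl
if-∧ false d x z = refl

neg-if : ∀ c (x : ℤ) → - (if c then x else 0ℤ) ≡ (if c then - x else 0ℤ)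
neg-if true x = refl
neg-if false x = refl

if≡𝟙* : ∀ c (v : ℤ) → (if c then v else 0ℤ) ≡ 𝟙 c * v
if≡𝟙* true v = sym (ℤP.*-identityˡ v)
if≡𝟙* false v = refl

+-≡ᵇ-split : ∀ b S t → (b ℕ.+ S ≡ᵇ t) ≡ (b ≤ᵇ t) ∧ (S ≡ᵇ t ∸ b)
+-≡ᵇ-split zero S t = refl
+-≡ᵇ-split (suc b) S zero = refl
+-≡ᵇ-split (suc b) S (suc t) = trans (+-≡ᵇ-split b S t) (cong (_∧ (S ≡ᵇ t ∸ b)) (sym (≤ᵇ-suc b t)))
  where
  ≤ᵇ-suc : ∀ b t → (b <ᵇ suc t) ≡ (b ≤ᵇ t)
  ≤ᵇ-suc zero t = refl
  ≤ᵇ-suc (suc b) t = refl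

∑ : {A : Set} → List A → (A → ℤ) → ℤ
∑ xs f = sumℤ (map f xs)

infixr 9 ∑ ∑<
syntax ∑ xs (λ x → e) = ∑[ x ∈ xs ] e

∑< : ℕ → (ℕ → ℤ) → ℤ
∑< m f = sumℤ (applyUpTo f m)

syntax ∑< m (λ i → e) = ∑[ i < m ] e

private variable
  A B : Set

∑-cong : ∀ (xs : List A) {f g} → (∀ x → f x ≡ g x) → ∑ xs f ≡ ∑ xs g
∑-cong [] _ = refl
∑-cong (x ∷ xs) f≗g = cong₂ _+_ (f≗g x) (∑-cong xs f≗g)

∑-0 : ∀ (xs : List A) → ∑[ x ∈ xs ] 0ℤ ≡ 0ℤ
∑-0 [] = refl
∑-0 (x ∷ xs) = trans (ℤP.+-identityˡ _) (∑-0 xs)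

∑-distrib-+ : ∀ (xs : List A) f g → ∑[ x ∈ xs ] (f x + g x) ≡ ∑ xs f + ∑ xs g
∑-distrib-+ [] f g = refl
∑-distrib-+ (x ∷ xs) f g = begin
  f x + g x + ∑[ x ∈ xs ] (f x + g x)  ≡⟨ cong (f x + g x +_) (∑-distrib-+ xs f g) ⟩
  f x + g x + (∑ xs f + ∑ xs g)         ≡⟨ interchange (f x) (g x) _ _ ⟩
  f x + ∑ xs f + (g x + ∑ xs g)         ∎
  where open ≡-Reasoning

∑-neg : ∀ (xs : List A) f → ∑[ x ∈ xs ] (- f x) ≡ - ∑ xs f
∑-neg [] f = refl
∑-neg (x ∷ xs) f = trans (cong (- f x +_) (∑-neg xs f)) (sym (ℤP.neg-distrib-+ (f x) _))

∑-if : ∀ (xs : List A) c f → ∑[ x ∈ xs ] (if c then f x else 0ℤ) ≡ (if c then ∑ xs f else 0ℤ)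
∑-if xs true f = refl
∑-if xs false f = ∑-0 xs

∑-++ : ∀ (xs ys : List A) f → ∑ (xs ++ ys) f ≡ ∑ xs f + ∑ ys f
∑-++ [] ys f = sym (ℤP.+-identityˡ _)
∑-++ (x ∷ xs) ys f = trans (cong (f x +_) (∑-++ xs ys f)) (sym (ℤP.+-assoc (f x) _ _))

∑-concatMap : ∀ (g : A → List B) (xs : List A) f → ∑ (concatMap g xs) f ≡ ∑[ x ∈ xs ] ∑ (g x) f
∑-concatMap g [] f = refl
∑-concatMap g (x ∷ xs) f = trans (∑-++ (g x) (concatMap g xs) f) (cong (∑ (g x) f +_) (∑-concatMap g xs f))

∑-map : ∀ (h : A → B) (xs : List A) f → ∑ (map h xs) f ≡ ∑ xs (f ∘ h)
∑-map h xs f = cong sumℤ (sym (ListP.map-∘ xs))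

∑-upTo : ∀ m f → ∑ (upTo m) f ≡ ∑< m f
∑-upTo m f = cong sumℤ (ListP.map-upTo f m)

∑<-cong : ∀ m {f g} → (∀ i → i < m → f i ≡ g i) → ∑< m f ≡ ∑< m g
∑<-cong zero _ = refl
∑<-cong (suc m) f≗g = cong₂ _+_ (f≗g 0 (s≤s z≤n)) (∑<-cong m (λ i i<m → f≗g (suc i) (s≤s i<m)))

∑<-0 : ∀ m → ∑[ i < m ] 0ℤ ≡ 0ℤ
∑<-0 zero = refl
∑<-0 (suc m) = trans (ℤP.+-identityˡ _) (∑<-0 m)

∑<-distrib-+ : ∀ m f g → ∑[ i < m ] (f i + g i) ≡ ∑< m f + ∑< m g
∑<-distrib-+ m f g = begin
  ∑[ i < m ] (f i + g i)       ≡⟨ ∑-upTo m _ ⟨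
  ∑[ i ∈ upTo m ] (f i + g i)  ≡⟨ ∑-distrib-+ (upTo m) f g ⟩
  ∑ (upTo m) f + ∑ (upTo m) g  ≡⟨ cong₂ _+_ (∑-upTo m f) (∑-upTo m g) ⟩
  ∑< m f + ∑< m g              ∎
  where open ≡-Reasoning

*-distribˡ-∑< : ∀ m c f → ∑[ i < m ] (c * f i) ≡ c * ∑< m f
*-distribˡ-∑< zero c f = sym (ℤP.*-zeroʳ c)
*-distribˡ-∑< (suc m) c f =
  trans (cong (c * f 0 +_) (*-distribˡ-∑< m c (f ∘ suc))) (sym (ℤP.*-distribˡ-+ c (f 0) _))

∑<-suc : ∀ m f → ∑< (suc m) f ≡ ∑< m f + f m
∑<-suc zero f = ℤP.+-comm (f 0) 0ℤ
∑<-suc (suc m) f = trans (cong (f 0 +_) (∑<-suc m (f ∘ suc))) (sym (ℤP.+-assoc (f 0) _ _))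

∑<-reverse : ∀ m f → ∑< m f ≡ ∑[ i < m ] f (m ∸ suc i)
∑<-reverse zero f = refl
∑<-reverse (suc m) f = begin
  f 0 + ∑< m (f ∘ suc)                      ≡⟨ cong (f 0 +_) (∑<-reverse m (f ∘ suc)) ⟩
  f 0 + ∑[ i < m ] f (suc (m ∸ suc i))      ≡⟨ ℤP.+-comm (f 0) _ ⟩
  ∑[ i < m ] f (suc (m ∸ suc i)) + f 0      ≡⟨ cong₂ _+_ (∑<-cong m λ i i<m → cong f (sym (ℕP.+-∸-assoc 1 i<m)))
                                                        (cong f (sym (ℕP.n∸n≡0 m))) ⟩
  ∑[ i < m ] f (suc m ∸ suc i) + f (m ∸ m)  ≡⟨ ∑<-suc m (λ i → f (suc m ∸ suc i)) ⟨
  ∑[ i < suc m ] f (suc m ∸ suc i)          ∎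
  where open ≡-Reasoning

∑<-select : ∀ m x (g : ℕ → ℤ) → ∑[ j < m ] (𝟙 (x ≡ᵇ j) * g j) ≡ 𝟙 (x <ᵇ m) * g x
∑<-select zero x g = refl
∑<-select (suc m) zero g = begin
  1ℤ * g 0 + ∑[ j < m ] (0ℤ * g (suc j))  ≡⟨ cong (1ℤ * g 0 +_) (∑<-0 m) ⟩
  1ℤ * g 0 + 0ℤ                           ≡⟨ ℤP.+-identityʳ _ ⟩
  1ℤ * g 0                                 ∎
  where open ≡-Reasoning
∑<-select (suc m) (suc x) g =
  trans (ℤP.+-identityˡ (∑[ j < m ] (𝟙 (x ≡ᵇ j) * g (suc j)))) (∑<-select m x (g ∘ suc))

∑<-extend : ∀ m d (g : ℕ → ℤ) → (∀ j → m ≤ j → g j ≡ 0ℤ) → ∑< (m ℕ.+ d) g ≡ ∑< m g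
∑<-extend m zero g _ rewrite ℕP.+-identityʳ m = refl
∑<-extend m (suc d) g g≡0 rewrite ℕP.+-suc m d =
  trans (∑<-suc (m ℕ.+ d) g) (trans (cong₂ _+_ (∑<-extend m d g g≡0) (g≡0 (m ℕ.+ d) (ℕP.m≤m+n m d))) (ℤP.+-identityʳ _))

reflects-true : ∀ {P : Set} {b} → Reflects P b → P → b ≡ true
reflects-true (ofʸ _) _ = refl
reflects-true (ofⁿ ¬p) p = ⊥-elim (¬p p)

reflects-false : ∀ {P : Set} {b} → Reflects P b → ¬ P → b ≡ false
reflects-false (ofʸ p) ¬p = ⊥-elim (¬p p)
reflects-false (ofⁿ _) _ = refl

<ᵇ-true : ∀ {m n} → m < n → (m <ᵇ n) ≡ true
<ᵇ-true {m} {n} = reflects-true (ℕP.<ᵇ-reflects-< m n)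

<ᵇ-false : ∀ {m n} → n ≤ m → (m <ᵇ n) ≡ false
<ᵇ-false {m} {n} n≤m = reflects-false (ℕP.<ᵇ-reflects-< m n) (ℕP.≤⇒≯ n≤m)

≤ᵇ-true : ∀ {m n} → m ≤ n → (m ≤ᵇ n) ≡ true
≤ᵇ-true {m} {n} = reflects-true (ℕP.≤ᵇ-reflects-≤ m n)

≡ᵇ-false : ∀ {m n} → m ≢ n → (m ≡ᵇ n) ≡ false
≡ᵇ-false {m} {n} = reflects-false (≡ᵇ-reflects-≡ m n)

reflects-invert : ∀ {P : Set} {b} → Reflects P b → b ≡ true → P
reflects-invert (ofʸ p) _ = p

≤ᵇ≡true⇒≤ : ∀ {m n} → (m ≤ᵇ n) ≡ true → m ≤ n
≤ᵇ≡true⇒≤ {m} {n} = reflects-invert (ℕP.≤ᵇ-reflects-≤ m n)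

≡ᵇ≡true⇒≡ : ∀ {m n} → (m ≡ᵇ n) ≡ true → m ≡ n
≡ᵇ≡true⇒≡ {m} {n} = reflects-invert (≡ᵇ-reflects-≡ m n)

infix 4 _≋_

record _≋_ (f g : Series) : Set where
  constructor mk≋
  field coeff : ∀ n → f n ≡ g n
open _≋_ public

0S : Series
0S = constS 0ℤ

0S-coeff : ∀ n → 0S n ≡ 0ℤ
0S-coeff zero = refl
0S-coeff (suc n) = refl

shift : Series → Series
shift f n = f (suc n)

⊛-coeff : ∀ f g n → (f ⊛ g) n ≡ ∑[ i < suc n ] (f i * g (n ∸ i))
⊛-coeff f g n = ∑-upTo (suc n) (λ i → f i * g (n ∸ i))

⊛-coeff-0 : ∀ f g → (f ⊛ g) 0 ≡ f 0 * g 0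
⊛-coeff-0 f g = ℤP.+-identityʳ _

⊛-coeff-suc : ∀ f g n → (f ⊛ g) (suc n) ≡ f 0 * g (suc n) + (shift f ⊛ g) n
⊛-coeff-suc f g n = trans (⊛-coeff f g (suc n)) (cong (f 0 * g (suc n) +_) (sym (⊛-coeff (shift f) g n)))

⊛-cong : ∀ {f f′ g g′} → f ≋ f′ → g ≋ g′ → f ⊛ g ≋ f′ ⊛ g′
⊛-cong {f} {f′} {g} {g′} f≋f′ g≋g′ = mk≋ λ n → begin
  (f ⊛ g) n                              ≡⟨ ⊛-coeff f g n ⟩
  ∑[ i < suc n ] (f i * g (n ∸ i))       ≡⟨ ∑<-cong (suc n) (λ i _ → cong₂ _*_ (coeff f≋f′ i) (coeff g≋g′ (n ∸ i))) ⟩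
  ∑[ i < suc n ] (f′ i * g′ (n ∸ i))     ≡⟨ ⊛-coeff f′ g′ n ⟨
  (f′ ⊛ g′) n                            ∎
  where open ≡-Reasoning

⊛-comm : ∀ f g → f ⊛ g ≋ g ⊛ f
⊛-comm f g = mk≋ λ n → begin
  (f ⊛ g) n                                          ≡⟨ ⊛-coeff f g n ⟩
  ∑[ i < suc n ] (f i * g (n ∸ i))                   ≡⟨ ∑<-reverse (suc n) (λ i → f i * g (n ∸ i)) ⟩
  ∑[ i < suc n ] (f (n ∸ i) * g (n ∸ (n ∸ i)))       ≡⟨ ∑<-cong (suc n) (λ i i≤n →
                                                          trans (cong (f (n ∸ i) *_) (cong g (ℕP.m∸[m∸n]≡n (ℕP.≤-pred i≤n))))
                                                                (ℤP.*-comm (f (n ∸ i)) (g i))) ⟩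
  ∑[ i < suc n ] (g i * f (n ∸ i))                   ≡⟨ ⊛-coeff g f n ⟨
  (g ⊛ f) n                                          ∎
  where open ≡-Reasoning

⊛-distribʳ : ∀ f g h → (f ⊕ g) ⊛ h ≋ f ⊛ h ⊕ g ⊛ h
⊛-distribʳ f g h = mk≋ λ n → begin
  ((f ⊕ g) ⊛ h) n                                              ≡⟨ ⊛-coeff (f ⊕ g) h n ⟩
  ∑[ i < suc n ] ((f i + g i) * h (n ∸ i))                     ≡⟨ ∑<-cong (suc n) (λ i _ → ℤP.*-distribʳ-+ (h (n ∸ i)) (f i) (g i)) ⟩
  ∑[ i < suc n ] (f i * h (n ∸ i) + g i * h (n ∸ i))           ≡⟨ ∑<-distrib-+ (suc n) (λ i → f i * h (n ∸ i)) (λ i → g i * h (n ∸ i)) ⟩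
  ∑[ i < suc n ] (f i * h (n ∸ i)) + ∑[ i < suc n ] (g i * h (n ∸ i))
                                                               ≡⟨ cong₂ _+_ (⊛-coeff f h n) (⊛-coeff g h n) ⟨
  (f ⊛ h ⊕ g ⊛ h) n                                            ∎
  where open ≡-Reasoning

scale : ℤ → Series → Series
scale c f n = c * f n

scale-⊛ : ∀ c f g → scale c f ⊛ g ≋ scale c (f ⊛ g)
scale-⊛ c f g = mk≋ λ n → begin
  (scale c f ⊛ g) n                       ≡⟨ ⊛-coeff (scale c f) g n ⟩
  ∑[ i < suc n ] (c * f i * g (n ∸ i))    ≡⟨ ∑<-cong (suc n) (λ i _ → ℤP.*-assoc c (f i) (g (n ∸ i))) ⟩
  ∑[ i < suc n ] (c * (f i * g (n ∸ i)))  ≡⟨ *-distribˡ-∑< (suc n) c (λ i → f i * g (n ∸ i)) ⟩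
  c * ∑[ i < suc n ] (f i * g (n ∸ i))    ≡⟨ cong (c *_) (⊛-coeff f g n) ⟨
  c * (f ⊛ g) n                           ∎
  where open ≡-Reasoning

⊛-shiftˡ : ∀ f g → shift (f ⊛ g) ≋ scale (f 0) (shift g) ⊕ shift f ⊛ g
⊛-shiftˡ f g = mk≋ (⊛-coeff-suc f g)

⊛-assoc-coeff : ∀ f g h n → ((f ⊛ g) ⊛ h) n ≡ (f ⊛ (g ⊛ h)) n
⊛-assoc-coeff f g h zero = begin
  ((f ⊛ g) ⊛ h) 0      ≡⟨ trans (⊛-coeff-0 (f ⊛ g) h) (cong (_* h 0) (⊛-coeff-0 f g)) ⟩
  f 0 * g 0 * h 0       ≡⟨ ℤP.*-assoc (f 0) (g 0) (h 0) ⟩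
  f 0 * (g 0 * h 0)     ≡⟨ trans (⊛-coeff-0 f (g ⊛ h)) (cong (f 0 *_) (⊛-coeff-0 g h)) ⟨
  (f ⊛ (g ⊛ h)) 0       ∎
  where open ≡-Reasoning
⊛-assoc-coeff f g h (suc n) = begin
  ((f ⊛ g) ⊛ h) (suc n)
    ≡⟨ ⊛-coeff-suc (f ⊛ g) h n ⟩
  (f ⊛ g) 0 * h (suc n) + (shift (f ⊛ g) ⊛ h) n
    ≡⟨ cong₂ _+_ (cong (_* h (suc n)) (⊛-coeff-0 f g)) (coeff (⊛-cong {g = h} (⊛-shiftˡ f g) (mk≋ λ _ → refl)) n) ⟩
  f 0 * g 0 * h (suc n) + ((scale (f 0) (shift g) ⊕ shift f ⊛ g) ⊛ h) n
    ≡⟨ cong (f 0 * g 0 * h (suc n) +_) (coeff (⊛-distribʳ (scale (f 0) (shift g)) (shift f ⊛ g) h) n) ⟩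
  f 0 * g 0 * h (suc n) + ((scale (f 0) (shift g) ⊛ h) n + ((shift f ⊛ g) ⊛ h) n)
    ≡⟨ cong (f 0 * g 0 * h (suc n) +_) (cong₂ _+_ (coeff (scale-⊛ (f 0) (shift g) h) n) (⊛-assoc-coeff (shift f) g h n)) ⟩
  f 0 * g 0 * h (suc n) + (f 0 * (shift g ⊛ h) n + (shift f ⊛ (g ⊛ h)) n)
    ≡⟨ regroup (f 0) (g 0) (h (suc n)) _ _ ⟩
  f 0 * (g 0 * h (suc n) + (shift g ⊛ h) n) + (shift f ⊛ (g ⊛ h)) n
    ≡⟨ cong (λ x → f 0 * x + (shift f ⊛ (g ⊛ h)) n) (⊛-coeff-suc g h n) ⟨
  f 0 * (g ⊛ h) (suc n) + (shift f ⊛ (g ⊛ h)) n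
    ≡⟨ ⊛-coeff-suc f (g ⊛ h) n ⟨
  (f ⊛ (g ⊛ h)) (suc n) ∎
  where
  open ≡-Reasoning
  regroup : ∀ a b c d e → a * b * c + (a * d + e) ≡ a * (b * c + d) + e
  regroup = solve-∀
⊛-identityˡ : ∀ f → oneS ⊛ f ≋ f
⊛-identityˡ f = mk≋ λ
  { zero → trans (⊛-coeff-0 oneS f) (ℤP.*-identityˡ (f 0))
  ; (suc n) → begin
      (oneS ⊛ f) (suc n)                 ≡⟨ ⊛-coeff-suc oneS f n ⟩
      1ℤ * f (suc n) + (shift oneS ⊛ f) n ≡⟨ cong₂ _+_ (ℤP.*-identityˡ (f (suc n))) (trans (⊛-coeff (shift oneS) f n) (∑<-0 (suc n))) ⟩
      f (suc n) + 0ℤ                     ≡⟨ ℤP.+-identityʳ _ ⟩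
      f (suc n)                          ∎ }
  where open ≡-Reasoning

SeriesRing : CommutativeRing 0ℓ 0ℓ
SeriesRing = record
  { Carrier = Series
  ; _≈_ = _≋_
  ; _+_ = _⊕_
  ; _*_ = _⊛_
  ; -_ = ⊖_
  ; 0# = 0S
  ; 1# = oneS
  ; isCommutativeRing = record
    { isRing = record
      { +-isAbelianGroup = record
        { isGroup = record
          { isMonoid = record
            { isSemigroup = record
              { isMagma = record
                { isEquivalence = record
                  { refl = mk≋ λ _ → refl
                  ; sym = λ p → mk≋ λ n → sym (coeff p n)
                  ; trans = λ p q → mk≋ λ n → trans (coeff p n) (coeff q n) }
                ; ∙-cong = λ p q → mk≋ λ n → cong₂ _+_ (coeff p n) (coeff q n) }
              ; assoc = λ f g h → mk≋ λ n → ℤP.+-assoc (f n) (g n) (h n) }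
            ; identity = (λ f → mk≋ λ n → trans (cong (_+ f n) (0S-coeff n)) (ℤP.+-identityˡ (f n)))
                       , (λ f → mk≋ λ n → trans (cong (f n +_) (0S-coeff n)) (ℤP.+-identityʳ (f n))) }
          ; inverse = (λ f → mk≋ λ n → trans (ℤP.+-inverseˡ (f n)) (sym (0S-coeff n)))
                    , (λ f → mk≋ λ n → trans (ℤP.+-inverseʳ (f n)) (sym (0S-coeff n)))
          ; ⁻¹-cong = λ p → mk≋ λ n → cong -_ (coeff p n) }
        ; comm = λ f g → mk≋ λ n → ℤP.+-comm (f n) (g n) }
      ; *-cong = ⊛-cong
      ; *-assoc = λ f g h → mk≋ (⊛-assoc-coeff f g h)
      ; *-identity = ⊛-identityˡ , λ f → ≋trans (⊛-comm f oneS) (⊛-identityˡ f)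
      ; distrib = (λ h f g → ≋trans (⊛-comm h (f ⊕ g))
                                    (≋trans (⊛-distribʳ f g h) (mk≋ λ n → cong₂ _+_ (coeff (⊛-comm f h) n) (coeff (⊛-comm g h) n))))
                , (λ h f g → ⊛-distribʳ f g h) }
    ; *-comm = ⊛-comm } }
  where
  ≋trans : ∀ {f g h} → f ≋ g → g ≋ h → f ≋ h
  ≋trans p q = mk≋ λ n → trans (coeff p n) (coeff q n)

open CommutativeRing SeriesRing public using ()
  renaming ( refl to ≋-refl; sym to ≋-sym; trans to ≋-trans; setoid to ≋-setoid; reflexive to ≋-reflexive
           ; +-cong to ⊕-cong; -‿cong to ⊖-cong; *-assoc to ⊛-assoc; *-identityʳ to ⊛-identityʳ; distribˡ to ⊛-distribˡ)

module ≋-Reasoning = SetoidReasoning ≋-setoid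

⊛-congˡ : ∀ h {f g} → f ≋ g → h ⊛ f ≋ h ⊛ g
⊛-congˡ h = ⊛-cong (≋-refl {h})

⊛-congʳ : ∀ h {f g} → f ≋ g → f ⊛ h ≋ g ⊛ h
⊛-congʳ h f≋g = ⊛-cong f≋g (≋-refl {h})

⊕-congˡ : ∀ h {f g} → f ≋ g → h ⊕ f ≋ h ⊕ g
⊕-congˡ h = ⊕-cong (≋-refl {h})

⊕-congʳ : ∀ h {f g} → f ≋ g → f ⊕ h ≋ g ⊕ h
⊕-congʳ h f≋g = ⊕-cong f≋g (≋-refl {h})

constS-⊛ : ∀ c f → constS c ⊛ f ≋ scale c f
constS-⊛ c f = mk≋ λ
  { zero → ⊛-coeff-0 (constS c) f
  ; (suc n) → trans (⊛-coeff-suc (constS c) f n)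
                    (trans (cong (c * f (suc n) +_) (trans (⊛-coeff (shift (constS c)) f n) (∑<-0 (suc n))))
                           (ℤP.+-identityʳ _)) }

module SeriesSolver where

  constS-homomorphism : ℤ.+-*-rawRing ACR.-Raw-AlmostCommutative⟶ ACR.fromCommutativeRing SeriesRing
  constS-homomorphism = record
    { ⟦_⟧ = constS
    ; +-homo = λ a b → mk≋ λ { zero → refl ; (suc n) → refl }
    ; *-homo = λ a b → ≋-sym (≋-trans (constS-⊛ a (constS b)) (mk≋ λ { zero → refl ; (suc n) → ℤP.*-zeroʳ a }))
    ; -‿homo = λ a → mk≋ λ { zero → refl ; (suc n) → refl }
    ; 0-homo = mk≋ λ { zero → refl ; (suc n) → refl }
    ; 1-homo = mk≋ λ { zero → refl ; (suc n) → refl } }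

  constS-≟ : ∀ a b → Maybe (constS a ≋ constS b)
  constS-≟ a b with a ℤP.≟ b
  ... | yes refl = just ≋-refl
  ... | no _ = nothing

  open import Algebra.Solver.Ring ℤ.+-*-rawRing (ACR.fromCommutativeRing SeriesRing) constS-homomorphism constS-≟ public
    using (solve; _:=_; _:+_; _:*_; :-_; _:-_; con)

X^_ : ℕ → Series
X^ e = mono 1ℤ e

mono-⊛-coeff-< : ∀ c e f t → t < e → (mono c e ⊛ f) t ≡ 0ℤ
mono-⊛-coeff-< c (suc e) f zero _ = ⊛-coeff-0 (mono c (suc e)) f
mono-⊛-coeff-< c (suc e) f (suc t) (s≤s t<e) =
  trans (⊛-coeff-suc (mono c (suc e)) f t) (trans (ℤP.+-identityˡ _) (mono-⊛-coeff-< c e f t t<e))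

mono-⊛-coeff-≥ : ∀ c e f t → e ≤ t → (mono c e ⊛ f) t ≡ c * f (t ∸ e)
mono-⊛-coeff-≥ c zero f zero _ = ⊛-coeff-0 (mono c 0) f
mono-⊛-coeff-≥ c zero f (suc t) _ =
  trans (⊛-coeff-suc (mono c 0) f t) (trans (cong (c * f (suc t) +_) (⊛-coeff (shift (mono c 0)) f t))
        (trans (cong (c * f (suc t) +_) (∑<-0 (suc t))) (ℤP.+-identityʳ _)))
mono-⊛-coeff-≥ c (suc e) f (suc t) (s≤s e≤t) =
  trans (⊛-coeff-suc (mono c (suc e)) f t) (trans (ℤP.+-identityˡ _) (mono-⊛-coeff-≥ c e f t e≤t))

mono≋constS⊛X^ : ∀ c e → mono c e ≋ constS c ⊛ X^ e
mono≋constS⊛X^ c e = mk≋ λ t → sym (trans (coeff (constS-⊛ c (X^ e)) t) (scaled t))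
  where
  scaled : ∀ t → c * (X^ e) t ≡ mono c e t
  scaled t with t ≡ᵇ e
  ... | true  = ℤP.*-identityʳ c
  ... | false = ℤP.*-zeroʳ c

mono-neg : ∀ e → mono (- 1ℤ) e ≋ ⊖ X^ e
mono-neg e = mk≋ λ t → negated (t ≡ᵇ e)
  where
  negated : ∀ b → (if b then - 1ℤ else 0ℤ) ≡ - (if b then 1ℤ else 0ℤ)
  negated true = refl
  negated false = refl

X^0≋1 : X^ 0 ≋ oneS
X^0≋1 = mk≋ λ { zero → refl ; (suc n) → refl }

X^-suc : ∀ e → X^ (suc e) ≋ X^ 1 ⊛ X^ e
X^-suc e = mk≋ λ
  { zero → sym (mono-⊛-coeff-< 1ℤ 1 (X^ e) 0 (s≤s z≤n))
  ; (suc t) → sym (trans (mono-⊛-coeff-≥ 1ℤ 1 (X^ e) (suc t) (s≤s z≤n)) (ℤP.*-identityˡ _)) }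

X^-+ : ∀ a b → X^ (a ℕ.+ b) ≋ X^ a ⊛ X^ b
X^-+ zero b = ≋-sym (≋-trans (⊛-congʳ (X^ b) X^0≋1) (⊛-identityˡ (X^ b)))
X^-+ (suc a) b = begin
  X^ (suc a ℕ.+ b)          ≈⟨ X^-suc (a ℕ.+ b) ⟩
  X^ 1 ⊛ X^ (a ℕ.+ b)       ≈⟨ ⊛-congˡ (X^ 1) (X^-+ a b) ⟩
  X^ 1 ⊛ (X^ a ⊛ X^ b)      ≈⟨ ⊛-assoc (X^ 1) (X^ a) (X^ b) ⟨
  X^ 1 ⊛ X^ a ⊛ X^ b        ≈⟨ ⊛-congʳ (X^ b) (X^-suc a) ⟨
  X^ (suc a) ⊛ X^ b         ∎
  where open ≋-Reasoning

invStep-stable : ∀ f d m → invStep f (m ℕ.+ d) m ≡ inv f m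
invStep-stable f zero m = cong (λ n → invStep f n m) (ℕP.+-identityʳ m)
invStep-stable f (suc d) m
  rewrite ℕP.+-suc m d | reflects-false (≡ᵇ-reflects-≡ m (suc (m ℕ.+ d))) (ℕP.<⇒≢ (s≤s (ℕP.m≤m+n m d)))
  = invStep-stable f d m

invStep≡inv : ∀ f {m n} → m ≤ n → invStep f n m ≡ inv f m
invStep≡inv f {m} m≤n = trans (cong (λ n → invStep f n m) (sym (ℕP.m+[n∸m]≡n m≤n))) (invStep-stable f _ m)

inv-coeff-suc : ∀ f n → inv f (suc n) ≡ - ∑[ j < suc n ] (f (suc j) * inv f (n ∸ j))
inv-coeff-suc f n rewrite ≡ᵇ-refl n = cong -_ (trans (∑-upTo (suc n) (λ j → f (suc j) * invStep f n (n ∸ j)))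
  (∑<-cong (suc n) (λ j _ → cong (f (suc j) *_) (invStep≡inv f (ℕP.m∸n≤m n j)))))

⊛-inverseʳ : ∀ f → f 0 ≡ 1ℤ → f ⊛ inv f ≋ oneS
⊛-inverseʳ f f₀≡1 = mk≋ λ
  { zero → trans (⊛-coeff-0 f (inv f)) (cong (_* 1ℤ) f₀≡1)
  ; (suc n) → begin
      (f ⊛ inv f) (suc n)                          ≡⟨ ⊛-coeff-suc f (inv f) n ⟩
      f 0 * inv f (suc n) + (shift f ⊛ inv f) n    ≡⟨ cong₂ _+_ (trans (cong (_* inv f (suc n)) f₀≡1) (ℤP.*-identityˡ _))
                                                                (⊛-coeff (shift f) (inv f) n) ⟩
      inv f (suc n) + ∑[ j < suc n ] (f (suc j) * inv f (n ∸ j))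
                                                   ≡⟨ cong (_+ S n) (inv-coeff-suc f n) ⟩
      - S n + S n                                  ≡⟨ ℤP.+-inverseˡ (S n) ⟩
      0ℤ                                           ∎ }
  where
  open ≡-Reasoning
  S : ℕ → ℤ
  S n = ∑[ j < suc n ] (f (suc j) * inv f (n ∸ j))

⊛-inverseˡ : ∀ f → f 0 ≡ 1ℤ → inv f ⊛ f ≋ oneS
⊛-inverseˡ f f₀≡1 = ≋-trans (⊛-comm (inv f) f) (⊛-inverseʳ f f₀≡1)

f⊛g≋h⇒g≋f⁻¹⊛h : ∀ f {g h} → f 0 ≡ 1ℤ → f ⊛ g ≋ h → g ≋ inv f ⊛ h
f⊛g≋h⇒g≋f⁻¹⊛h f {g} {h} f₀≡1 f⊛g≋h = begin
  g                  ≈⟨ ⊛-identityˡ g ⟨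
  oneS ⊛ g           ≈⟨ ⊛-congʳ g (⊛-inverseˡ f f₀≡1) ⟨
  inv f ⊛ f ⊛ g      ≈⟨ ⊛-assoc (inv f) f g ⟩
  inv f ⊛ (f ⊛ g)    ≈⟨ ⊛-congˡ (inv f) f⊛g≋h ⟩
  inv f ⊛ h          ∎
  where open ≋-Reasoning

⊛-coeff-0-≡1 : ∀ {f g} → f 0 ≡ 1ℤ → g 0 ≡ 1ℤ → (f ⊛ g) 0 ≡ 1ℤ
⊛-coeff-0-≡1 {f} {g} f₀≡1 g₀≡1 = trans (⊛-coeff-0 f g) (cong₂ _*_ f₀≡1 g₀≡1)

inv-distrib-⊛ : ∀ f g → f 0 ≡ 1ℤ → g 0 ≡ 1ℤ → inv (f ⊛ g) ≋ inv f ⊛ inv g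
inv-distrib-⊛ f g f₀≡1 g₀≡1 = ≋-sym (begin
  inv f ⊛ inv g                         ≈⟨ ⊛-identityʳ _ ⟨
  inv f ⊛ inv g ⊛ oneS                  ≈⟨ ⊛-congˡ (inv f ⊛ inv g) (⊛-inverseʳ (f ⊛ g) fg₀≡1) ⟨
  inv f ⊛ inv g ⊛ (f ⊛ g ⊛ inv (f ⊛ g)) ≈⟨ regroup (inv f) (inv g) f g (inv (f ⊛ g)) ⟩
  (inv f ⊛ f) ⊛ (inv g ⊛ g) ⊛ inv (f ⊛ g)
                                        ≈⟨ ⊛-congʳ (inv (f ⊛ g)) (⊛-cong (⊛-inverseˡ f f₀≡1) (⊛-inverseˡ g g₀≡1)) ⟩
  oneS ⊛ oneS ⊛ inv (f ⊛ g)             ≈⟨ units (inv (f ⊛ g)) ⟩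
  inv (f ⊛ g)                           ∎)
  where
  open ≋-Reasoning
  open SeriesSolver
  fg₀≡1 = ⊛-coeff-0-≡1 {f} {g} f₀≡1 g₀≡1
  regroup : ∀ a b c d e → a ⊛ b ⊛ (c ⊛ d ⊛ e) ≋ (a ⊛ c) ⊛ (b ⊛ d) ⊛ e
  regroup = solve 5 (λ a b c d e → a :* b :* (c :* d :* e) := (a :* c) :* (b :* d) :* e) ≋-refl
  units : ∀ a → oneS ⊛ oneS ⊛ a ≋ a
  units = solve 1 (λ a → con 1ℤ :* con 1ℤ :* a := a) ≋-refl

-- Agreement up to a given degree

infix 4 _≈[_]_

record _≈[_]_ (f : Series) (t : ℕ) (g : Series) : Set where
  constructor mk≈
  field coeff≤ : ∀ i → i ≤ t → f i ≡ g i
open _≈[_]_ public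

≈[]-setoid : ℕ → Setoid 0ℓ 0ℓ
≈[]-setoid t = record
  { Carrier = Series
  ; _≈_ = _≈[ t ]_
  ; isEquivalence = record
    { refl = mk≈ λ _ _ → refl
    ; sym = λ p → mk≈ λ i i≤t → sym (coeff≤ p i i≤t)
    ; trans = λ p q → mk≈ λ i i≤t → trans (coeff≤ p i i≤t) (coeff≤ q i i≤t) } }

module ≈[]-Reasoning (t : ℕ) = SetoidReasoning (≈[]-setoid t)

≈[]-sym : ∀ {f g t} → f ≈[ t ] g → g ≈[ t ] f
≈[]-sym p = mk≈ λ i i≤t → sym (coeff≤ p i i≤t)

≋⇒≈[] : ∀ {f g t} → f ≋ g → f ≈[ t ] g
≋⇒≈[] f≋g = mk≈ λ i _ → coeff f≋g i

≈[]⇒≋ : ∀ {f g} → (∀ t → f ≈[ t ] g) → f ≋ g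
≈[]⇒≋ f≈g = mk≋ λ t → coeff≤ (f≈g t) t ℕP.≤-refl

⊕-≈[] : ∀ {f f′ g g′ t} → f ≈[ t ] f′ → g ≈[ t ] g′ → f ⊕ g ≈[ t ] f′ ⊕ g′
⊕-≈[] p q = mk≈ λ i i≤t → cong₂ _+_ (coeff≤ p i i≤t) (coeff≤ q i i≤t)

⊕-≈[]ˡ : ∀ h {f g t} → f ≈[ t ] g → h ⊕ f ≈[ t ] h ⊕ g
⊕-≈[]ˡ h p = mk≈ λ i i≤t → cong (h i +_) (coeff≤ p i i≤t)

⊕-≈[]ʳ : ∀ h {f g t} → f ≈[ t ] g → f ⊕ h ≈[ t ] g ⊕ h
⊕-≈[]ʳ h p = mk≈ λ i i≤t → cong (_+ h i) (coeff≤ p i i≤t)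

⊖-≈[] : ∀ {f f′ t} → f ≈[ t ] f′ → ⊖ f ≈[ t ] ⊖ f′
⊖-≈[] p = mk≈ λ i i≤t → cong -_ (coeff≤ p i i≤t)

⊛-≈[] : ∀ {f f′ g g′ t} → f ≈[ t ] f′ → g ≈[ t ] g′ → f ⊛ g ≈[ t ] f′ ⊛ g′
⊛-≈[] {f} {f′} {g} {g′} p q = mk≈ λ i i≤t → begin
  (f ⊛ g) i                              ≡⟨ ⊛-coeff f g i ⟩
  ∑[ j < suc i ] (f j * g (i ∸ j))       ≡⟨ ∑<-cong (suc i) (λ j j≤i →
                                              cong₂ _*_ (coeff≤ p j (ℕP.≤-trans (ℕP.≤-pred j≤i) i≤t))
                                                        (coeff≤ q (i ∸ j) (ℕP.≤-trans (ℕP.m∸n≤m i j) i≤t))) ⟩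
  ∑[ j < suc i ] (f′ j * g′ (i ∸ j))     ≡⟨ ⊛-coeff f′ g′ i ⟨
  (f′ ⊛ g′) i                            ∎
  where open ≡-Reasoning

⊛-≈[]ˡ : ∀ h {f g t} → f ≈[ t ] g → h ⊛ f ≈[ t ] h ⊛ g
⊛-≈[]ˡ h = ⊛-≈[] {h} {h} (mk≈ λ _ _ → refl)

invStep-≈[] : ∀ {f g t} → f ≈[ t ] g → ∀ {n} → n ≤ t → ∀ m → invStep f n m ≡ invStep g n m
invStep-≈[] p {zero} _ m = refl
invStep-≈[] {f} {g} p {suc n} n<t m with m ≡ᵇ suc n
... | true = cong -_ (trans (∑-upTo (suc n) (λ j → f (suc j) * invStep f n (n ∸ j))) (trans (∑<-cong (suc n) (λ j j≤n →
        cong₂ _*_ (coeff≤ p (suc j) (ℕP.≤-trans (s≤s (ℕP.≤-pred j≤n)) n<t))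
                  (invStep-≈[] p (ℕP.≤-trans (ℕP.n≤1+n n) n<t) (n ∸ j))))
        (sym (∑-upTo (suc n) (λ j → g (suc j) * invStep g n (n ∸ j))))))
... | false = invStep-≈[] p (ℕP.≤-trans (ℕP.n≤1+n n) n<t) m

inv-≈[] : ∀ {f g t} → f ≈[ t ] g → inv f ≈[ t ] inv g
inv-≈[] p = mk≈ λ i i≤t → invStep-≈[] p i≤t i

inv-cong : ∀ {f g} → f ≋ g → inv f ≋ inv g
inv-cong f≋g = ≈[]⇒≋ λ _ → inv-≈[] (≋⇒≈[] f≋g)

X^-⊛-≈[]-0 : ∀ e f {t} → t < e → X^ e ⊛ f ≈[ t ] 0S
X^-⊛-≈[]-0 e f t<e = mk≈ λ i i≤t → trans (mono-⊛-coeff-< 1ℤ e f i (ℕP.≤-<-trans i≤t t<e)) (sym (0S-coeff i))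

-- The products a_s

validAbove : ℕ → ℕ → Bool
validAbove s b = (s <ᵇ b) ∧ not (sameParity b s)

validAbove⇒> : ∀ {s b} → validAbove s b ≡ true → s < b
validAbove⇒> {s} {b} v = reflects-invert (ℕP.<ᵇ-reflects-< s b) (BoolP.∧-conicalˡ _ _ v)

ratioFactor : ℕ → Series
ratioFactor b = factor 1ℤ b ⊛ inv (factor (- 1ℤ) b)

-- a_s = (q^{s+1};q²)_∞ / (-q^{s+1};q²)_∞ truncated to the factors (1 - q^b)/(1 + q^b) with b < M.
pochRatio : ℕ → ℕ → Series
pochRatio s zero = oneS
pochRatio s (suc M) = if validAbove s M then pochRatio s M ⊛ ratioFactor M else pochRatio s M

pochRatio-valid : ∀ {s M} → validAbove s M ≡ true → pochRatio s (suc M) ≡ pochRatio s M ⊛ ratioFactor M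
pochRatio-valid v rewrite v = refl

pochRatio-invalid : ∀ {s M} → validAbove s M ≡ false → pochRatio s (suc M) ≡ pochRatio s M
pochRatio-invalid v rewrite v = refl

factor-coeff-0 : ∀ a e → 1 ≤ e → factor a e 0 ≡ 1ℤ
factor-coeff-0 a (suc e) _ = refl

factor≋ : ∀ e → factor 1ℤ e ≋ oneS ⊕ ⊖ X^ e
factor≋ e = ⊕-congˡ oneS (mono-neg e)

module _ (b : ℕ) (1≤b : 1 ≤ b) (z : Series) where
  private
    d = factor (- 1ℤ) b
    d₀≡1 = factor-coeff-0 (- 1ℤ) b 1≤b

  ⊛-inv-1+X^ : z ⊛ inv d ≋ z ⊕ ⊖ (X^ b ⊛ (z ⊛ inv d))
  ⊛-inv-1+X^ = begin
    z ⊛ inv d                                        ≈⟨ expand (z ⊛ inv d) (X^ b) ⟩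
    z ⊛ inv d ⊛ (oneS ⊕ X^ b) ⊕ ⊖ (X^ b ⊛ (z ⊛ inv d)) ≈⟨ ⊕-congʳ _ (≋-trans (⊛-assoc z (inv d) d)
                                                                   (≋-trans (⊛-congˡ z (⊛-inverseˡ d d₀≡1)) (⊛-identityʳ z))) ⟩
    z ⊕ ⊖ (X^ b ⊛ (z ⊛ inv d))                       ∎
    where
    open ≋-Reasoning
    open SeriesSolver
    expand : ∀ y x → y ≋ y ⊛ (oneS ⊕ x) ⊕ ⊖ (x ⊛ y)
    expand = solve 2 (λ y x → y := y :* (con 1ℤ :+ x) :- x :* y) ≋-refl

  ⊛-ratioFactor : z ⊛ ratioFactor b ≋ z ⊕ ⊖ (constS (ℤ.+ 2) ⊛ (X^ b ⊛ (z ⊛ inv d)))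
  ⊛-ratioFactor = begin
    z ⊛ (factor 1ℤ b ⊛ inv d)                                      ≈⟨ ⊛-congˡ z (⊛-congʳ (inv d) (factor≋ b)) ⟩
    z ⊛ ((oneS ⊕ ⊖ X^ b) ⊛ inv d)                                  ≈⟨ split z (X^ b) (inv d) ⟩
    z ⊛ ((oneS ⊕ X^ b) ⊛ inv d) ⊕ ⊖ (constS (ℤ.+ 2) ⊛ (X^ b ⊛ (z ⊛ inv d)))
                                                                   ≈⟨ ⊕-congʳ _ (≋-trans (⊛-congˡ z (⊛-inverseʳ d d₀≡1)) (⊛-identityʳ z)) ⟩
    z ⊕ ⊖ (constS (ℤ.+ 2) ⊛ (X^ b ⊛ (z ⊛ inv d)))                   ∎
    where
    open ≋-Reasoning
    open SeriesSolver
    split : ∀ z x i → z ⊛ ((oneS ⊕ ⊖ x) ⊛ i) ≋ z ⊛ ((oneS ⊕ x) ⊛ i) ⊕ ⊖ (constS (ℤ.+ 2) ⊛ (x ⊛ (z ⊛ i)))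
    split = solve 3 (λ z x i → z :* ((con 1ℤ :- x) :* i) := z :* ((con 1ℤ :+ x) :* i) :- con (ℤ.+ 2) :* (x :* (z :* i))) ≋-refl

sameParity-suc : ∀ s → sameParity (suc s) s ≡ false
sameParity-suc zero = refl
sameParity-suc (suc s) = trans (≡ᵇ-sym (s % 2) (suc s % 2)) (sameParity-suc s)

pochRatio-trivial : ∀ s M → M ≤ suc s → pochRatio s M ≋ oneS
pochRatio-trivial s zero _ = ≋-refl
pochRatio-trivial s (suc M) (s≤s M≤s) =
  ≋-trans (≋-reflexive (pochRatio-invalid {s} {M} (cong (_∧ not (sameParity M s)) (<ᵇ-false M≤s)))) (pochRatio-trivial s M (ℕP.m≤n⇒m≤1+n M≤s))

validAbove-+2 : ∀ s M → suc (suc s) ≤ M → validAbove s M ≡ validAbove (suc (suc s)) M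
validAbove-+2 s M s+2≤M with ℕP.m≤n⇒m<n∨m≡n s+2≤M
... | inj₁ s+2<M rewrite <ᵇ-true {s} {M} (ℕP.<-trans (ℕP.n<1+n s) (ℕP.<-trans (ℕP.n<1+n (suc s)) s+2<M)) | <ᵇ-true s+2<M = refl
... | inj₂ refl rewrite <ᵇ-true {s} {suc (suc s)} (ℕP.<-trans (ℕP.n<1+n s) (ℕP.n<1+n (suc s))) | <ᵇ-false {suc (suc s)} {suc (suc s)} ℕP.≤-refl
                      | ≡ᵇ-refl (s % 2) = refl

pochRatio-shift : ∀ s d → pochRatio s (suc (suc s) ℕ.+ d) ≋ ratioFactor (suc s) ⊛ pochRatio (suc (suc s)) (suc (suc s) ℕ.+ d)
pochRatio-shift s zero rewrite ℕP.+-identityʳ s = begin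
  pochRatio s (suc (suc s))                        ≈⟨ ≋-reflexive (pochRatio-valid {s} {suc s} firstFactor) ⟩
  pochRatio s (suc s) ⊛ ratioFactor (suc s)        ≈⟨ ⊛-congʳ (ratioFactor (suc s)) (pochRatio-trivial s (suc s) ℕP.≤-refl) ⟩
  oneS ⊛ ratioFactor (suc s)                       ≈⟨ ⊛-comm oneS (ratioFactor (suc s)) ⟩
  ratioFactor (suc s) ⊛ oneS                       ≈⟨ ⊛-congˡ (ratioFactor (suc s)) (pochRatio-trivial (suc (suc s)) (suc (suc s)) (ℕP.n≤1+n _)) ⟨
  ratioFactor (suc s) ⊛ pochRatio (suc (suc s)) (suc (suc s)) ∎
  where
  open ≋-Reasoning
  firstFactor : validAbove s (suc s) ≡ true
  firstFactor rewrite <ᵇ-true (ℕP.n<1+n s) | sameParity-suc s = refl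
pochRatio-shift s (suc d) rewrite ℕP.+-suc s d = lastFactor (validAbove (suc (suc s)) M) refl
  where
  M = suc (suc s) ℕ.+ d
  open ≋-Reasoning
  lastFactor : ∀ v → validAbove (suc (suc s)) M ≡ v →
    pochRatio s (suc M) ≋ ratioFactor (suc s) ⊛ pochRatio (suc (suc s)) (suc M)
  lastFactor false v = begin
    pochRatio s (suc M)                       ≈⟨ ≋-reflexive (pochRatio-invalid {s} {M} (trans (validAbove-+2 s M (ℕP.m≤m+n _ d)) v)) ⟩
    pochRatio s M                             ≈⟨ pochRatio-shift s d ⟩
    ratioFactor (suc s) ⊛ pochRatio (suc (suc s)) M       ≈⟨ ⊛-congˡ (ratioFactor (suc s)) (≋-reflexive (pochRatio-invalid {suc (suc s)} {M} v)) ⟨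
    ratioFactor (suc s) ⊛ pochRatio (suc (suc s)) (suc M) ∎
  lastFactor true v = begin
    pochRatio s (suc M)                       ≈⟨ ≋-reflexive (pochRatio-valid {s} {M} (trans (validAbove-+2 s M (ℕP.m≤m+n _ d)) v)) ⟩
    pochRatio s M ⊛ ratioFactor M             ≈⟨ ⊛-congʳ (ratioFactor M) (pochRatio-shift s d) ⟩
    ratioFactor (suc s) ⊛ pochRatio (suc (suc s)) M ⊛ ratioFactor M
                                              ≈⟨ ⊛-assoc (ratioFactor (suc s)) (pochRatio (suc (suc s)) M) (ratioFactor M) ⟩
    ratioFactor (suc s) ⊛ (pochRatio (suc (suc s)) M ⊛ ratioFactor M)
                                              ≈⟨ ⊛-congˡ (ratioFactor (suc s)) (≋-reflexive (pochRatio-valid {suc (suc s)} {M} v)) ⟨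
    ratioFactor (suc s) ⊛ pochRatio (suc (suc s)) (suc M) ∎

1+X^⊛ratioFactor : ∀ b → 1 ≤ b → (oneS ⊕ X^ b) ⊛ ratioFactor b ≋ oneS ⊕ ⊖ X^ b
1+X^⊛ratioFactor b 1≤b = begin
  d ⊛ (factor 1ℤ b ⊛ inv d)     ≈⟨ swap d (factor 1ℤ b) (inv d) ⟩
  factor 1ℤ b ⊛ (d ⊛ inv d)     ≈⟨ ⊛-congˡ (factor 1ℤ b) (⊛-inverseʳ d (factor-coeff-0 (- 1ℤ) b 1≤b)) ⟩
  factor 1ℤ b ⊛ oneS            ≈⟨ ⊛-identityʳ (factor 1ℤ b) ⟩
  factor 1ℤ b                   ≈⟨ factor≋ b ⟩
  oneS ⊕ ⊖ X^ b                 ∎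
  where
  open ≋-Reasoning
  open SeriesSolver
  d = factor (- 1ℤ) b
  swap : ∀ x y z → x ⊛ (y ⊛ z) ≋ y ⊛ (x ⊛ z)
  swap = solve 3 (λ x y z → x :* (y :* z) := y :* (x :* z)) ≋-refl

pochRatio-recurrence : ∀ s M → suc (suc s) ≤ M →
  (oneS ⊕ X^ (suc s)) ⊛ pochRatio s M ≋ (oneS ⊕ ⊖ X^ (suc s)) ⊛ pochRatio (suc (suc s)) M
pochRatio-recurrence s M s+2≤M = begin
  (oneS ⊕ X^ (suc s)) ⊛ pochRatio s M
    ≈⟨ ⊛-congˡ (oneS ⊕ X^ (suc s)) (≋-trans (≋-reflexive (cong (pochRatio s) (sym M≡))) (pochRatio-shift s (M ∸ suc (suc s)))) ⟩
  (oneS ⊕ X^ (suc s)) ⊛ (ratioFactor (suc s) ⊛ pochRatio (suc (suc s)) (suc (suc s) ℕ.+ (M ∸ suc (suc s))))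
    ≈⟨ ⊛-assoc (oneS ⊕ X^ (suc s)) (ratioFactor (suc s)) (pochRatio (suc (suc s)) (suc (suc s) ℕ.+ (M ∸ suc (suc s)))) ⟨
  (oneS ⊕ X^ (suc s)) ⊛ ratioFactor (suc s) ⊛ pochRatio (suc (suc s)) (suc (suc s) ℕ.+ (M ∸ suc (suc s)))
    ≈⟨ ⊛-cong (1+X^⊛ratioFactor (suc s) (s≤s z≤n)) (≋-reflexive (cong (pochRatio (suc (suc s))) M≡)) ⟩
  (oneS ⊕ ⊖ X^ (suc s)) ⊛ pochRatio (suc (suc s)) M ∎
  where
  open ≋-Reasoning
  M≡ : suc (suc s) ℕ.+ (M ∸ suc (suc s)) ≡ M
  M≡ = ℕP.m+[n∸m]≡n s+2≤M

factor-≈[]-1 : ∀ a e {t} → t < e → factor a e ≈[ t ] oneS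
factor-≈[]-1 a e t<e = mk≈ λ i i≤t →
  trans (cong (λ c → oneS i + (if c then - a else 0ℤ)) (≡ᵇ-false (ℕP.<⇒≢ (ℕP.≤-<-trans i≤t t<e)))) (ℤP.+-identityʳ (oneS i))

inv-1 : inv oneS ≋ oneS
inv-1 = ≋-trans (≋-sym (⊛-identityˡ (inv oneS))) (⊛-inverseʳ oneS refl)

ratioFactor-≈[]-1 : ∀ b {t} → t < b → ratioFactor b ≈[ t ] oneS
ratioFactor-≈[]-1 b {t} t<b = begin
  factor 1ℤ b ⊛ inv (factor (- 1ℤ) b)   ≈⟨ ⊛-≈[] (factor-≈[]-1 1ℤ b t<b) (inv-≈[] (factor-≈[]-1 (- 1ℤ) b t<b)) ⟩
  oneS ⊛ inv oneS                       ≈⟨ ≋⇒≈[] (≋-trans (⊛-identityˡ (inv oneS)) inv-1) ⟩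
  oneS                                  ∎
  where open ≈[]-Reasoning t

pochRatio-step : ∀ s M {t} → t < M → pochRatio s (suc M) ≈[ t ] pochRatio s M
pochRatio-step s M {t} t<M with validAbove s M
... | false = mk≈ λ _ _ → refl
... | true = begin
  pochRatio s M ⊛ ratioFactor M   ≈⟨ ⊛-≈[]ˡ (pochRatio s M) (ratioFactor-≈[]-1 M t<M) ⟩
  pochRatio s M ⊛ oneS            ≈⟨ ≋⇒≈[] (⊛-identityʳ (pochRatio s M)) ⟩
  pochRatio s M                   ∎
  where open ≈[]-Reasoning t

pochRatio-stable : ∀ s M d {t} → t < M → pochRatio s (M ℕ.+ d) ≈[ t ] pochRatio s M
pochRatio-stable s M zero {t} t<M rewrite ℕP.+-identityʳ M = mk≈ λ _ _ → refl
pochRatio-stable s M (suc d) {t} t<M rewrite ℕP.+-suc M d = begin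
  pochRatio s (suc (M ℕ.+ d))   ≈⟨ pochRatio-step s (M ℕ.+ d) (ℕP.<-≤-trans t<M (ℕP.m≤m+n M d)) ⟩
  pochRatio s (M ℕ.+ d)         ≈⟨ pochRatio-stable s M d t<M ⟩
  pochRatio s M                 ∎
  where open ≈[]-Reasoning t

pochRatio-low : ∀ s M {t} → t ≤ s → pochRatio s M ≈[ t ] oneS
pochRatio-low s M {t} t≤s with M ℕP.≤? suc s
... | yes M≤s+1 = ≋⇒≈[] (pochRatio-trivial s M M≤s+1)
... | no M≰s+1 = begin
  pochRatio s M                          ≡⟨ cong (pochRatio s) (ℕP.m+[n∸m]≡n (ℕP.<⇒≤ (ℕP.≰⇒> M≰s+1))) ⟨
  pochRatio s (suc s ℕ.+ (M ∸ suc s))    ≈⟨ pochRatio-stable s (suc s) (M ∸ suc s) (s≤s t≤s) ⟩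
  pochRatio s (suc s)                    ≈⟨ ≋⇒≈[] (pochRatio-trivial s (suc s) ℕP.≤-refl) ⟩
  oneS                                   ∎
  where open ≈[]-Reasoning t

poch-coeff-0 : ∀ a m N → 1 ≤ m → poch a m N 0 ≡ 1ℤ
poch-coeff-0 a m zero _ = refl
poch-coeff-0 a m (suc N) 1≤m =
  ⊛-coeff-0-≡1 {poch a m N} {factor a (m ℕ.+ 2 ℕ.* N)} (poch-coeff-0 a m N 1≤m)
               (factor-coeff-0 a (m ℕ.+ 2 ℕ.* N) (ℕP.≤-trans 1≤m (ℕP.m≤m+n m _)))

poch-stable : ∀ a m N d {t} → t < m ℕ.+ 2 ℕ.* N → poch a m (N ℕ.+ d) ≈[ t ] poch a m N
poch-stable a m N zero t<m+2N rewrite ℕP.+-identityʳ N = mk≈ λ _ _ → refl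
poch-stable a m N (suc d) {t} t<m+2N rewrite ℕP.+-suc N d = begin
  poch a m (N ℕ.+ d) ⊛ factor a (m ℕ.+ 2 ℕ.* (N ℕ.+ d))
    ≈⟨ ⊛-≈[]ˡ (poch a m (N ℕ.+ d)) (factor-≈[]-1 a _ (ℕP.<-≤-trans t<m+2N (ℕP.+-monoʳ-≤ m (ℕP.*-monoʳ-≤ 2 (ℕP.m≤m+n N d))))) ⟩
  poch a m (N ℕ.+ d) ⊛ oneS
    ≈⟨ ≋⇒≈[] (⊛-identityʳ (poch a m (N ℕ.+ d))) ⟩
  poch a m (N ℕ.+ d)
    ≈⟨ poch-stable a m N d t<m+2N ⟩
  poch a m N ∎
  where open ≈[]-Reasoning t

pochInf-≈[] : ∀ a m N {t} → t < m ℕ.+ 2 ℕ.* N → pochInf a m ≈[ t ] poch a m N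
pochInf-≈[] a m N t<m+2N = mk≈ λ i i≤t → begin
  poch a m (suc i) i           ≡⟨ coeff≤ (poch-stable a m (suc i) N (deep i)) i ℕP.≤-refl ⟨
  poch a m (suc i ℕ.+ N) i     ≡⟨ cong (λ M → poch a m M i) (ℕP.+-comm (suc i) N) ⟩
  poch a m (N ℕ.+ suc i) i     ≡⟨ coeff≤ (poch-stable a m N (suc i) t<m+2N) i i≤t ⟩
  poch a m N i                 ∎
  where
  open ≡-Reasoning
  deep : ∀ i → i < m ℕ.+ 2 ℕ.* suc i
  deep i = ℕP.<-≤-trans (ℕP.n<1+n i) (ℕP.≤-trans (ℕP.m≤m+n (suc i) (suc i ℕ.+ 0)) (ℕP.m≤n+m (2 ℕ.* suc i) m))

oddRatio : Series
oddRatio = pochInf 1ℤ 1 ⊛ inv (pochInf (- 1ℤ) 1)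

even-sameParity : ∀ N → sameParity (2 ℕ.* N) 0 ≡ true
even-sameParity zero = refl
even-sameParity (suc N) = trans (cong (λ x → sameParity x 0) (ℕP.*-suc 2 N)) (even-sameParity N)

odd-sameParity : ∀ N → sameParity (suc (2 ℕ.* N)) 0 ≡ false
odd-sameParity zero = refl
odd-sameParity (suc N) = trans (cong (λ x → sameParity (suc x) 0) (ℕP.*-suc 2 N)) (odd-sameParity N)

pochRatio-0 : ∀ N → pochRatio 0 (2 ℕ.* N) ≋ poch 1ℤ 1 N ⊛ inv (poch (- 1ℤ) 1 N)
pochRatio-0 zero = ≋-sym (≋-trans (⊛-identityˡ (inv oneS)) inv-1)
pochRatio-0 (suc N) = begin
  pochRatio 0 (2 ℕ.* suc N)
    ≈⟨ ≋-reflexive (cong (pochRatio 0) (ℕP.*-suc 2 N)) ⟩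
  pochRatio 0 (suc (suc (2 ℕ.* N)))
    ≈⟨ ≋-reflexive (trans (pochRatio-valid {0} {suc (2 ℕ.* N)} (cong not (odd-sameParity N)))
                          (cong (_⊛ f) (pochRatio-invalid {0} {2 ℕ.* N}
                            (trans (cong (λ c → (0 <ᵇ 2 ℕ.* N) ∧ not c) (even-sameParity N)) (BoolP.∧-zeroʳ (0 <ᵇ 2 ℕ.* N)))))) ⟩
  pochRatio 0 (2 ℕ.* N) ⊛ (factor 1ℤ (suc (2 ℕ.* N)) ⊛ g)
    ≈⟨ ⊛-congʳ (factor 1ℤ (suc (2 ℕ.* N)) ⊛ g) (pochRatio-0 N) ⟩
  p ⊛ ip ⊛ (factor 1ℤ (suc (2 ℕ.* N)) ⊛ g)
    ≈⟨ regroup p ip (factor 1ℤ (suc (2 ℕ.* N))) g ⟩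
  (p ⊛ factor 1ℤ (suc (2 ℕ.* N))) ⊛ (ip ⊛ g)
    ≈⟨ ⊛-congˡ (poch 1ℤ 1 (suc N))
                (inv-distrib-⊛ (poch (- 1ℤ) 1 N) (factor (- 1ℤ) (suc (2 ℕ.* N))) (poch-coeff-0 (- 1ℤ) 1 N ℕP.≤-refl) refl) ⟨
  poch 1ℤ 1 (suc N) ⊛ inv (poch (- 1ℤ) 1 (suc N)) ∎
  where
  open ≋-Reasoning
  open SeriesSolver
  p = poch 1ℤ 1 N
  ip = inv (poch (- 1ℤ) 1 N)
  g = inv (factor (- 1ℤ) (suc (2 ℕ.* N)))
  f = factor 1ℤ (suc (2 ℕ.* N)) ⊛ g
  regroup : ∀ a b c d → a ⊛ b ⊛ (c ⊛ d) ≋ (a ⊛ c) ⊛ (b ⊛ d)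
  regroup = solve 4 (λ a b c d → a :* b :* (c :* d) := (a :* c) :* (b :* d)) ≋-refl

oddRatio-≈[] : ∀ N {t} → t < suc (2 ℕ.* N) → oddRatio ≈[ t ] pochRatio 0 (2 ℕ.* N)
oddRatio-≈[] N {t} t<2N+1 = begin
  pochInf 1ℤ 1 ⊛ inv (pochInf (- 1ℤ) 1)   ≈⟨ ⊛-≈[] (pochInf-≈[] 1ℤ 1 N t<2N+1) (inv-≈[] (pochInf-≈[] (- 1ℤ) 1 N t<2N+1)) ⟩
  poch 1ℤ 1 N ⊛ inv (poch (- 1ℤ) 1 N)     ≈⟨ ≋⇒≈[] (pochRatio-0 N) ⟨
  pochRatio 0 (2 ℕ.* N)                   ∎
  where open ≈[]-Reasoning t

-- Overpartitions by their smallest non-overlined part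

follows : ℕ → Part → Bool
follows a (b , y) = (b <ᵇ a) ∨ ((a ≡ᵇ b) ∧ not y)

headFollows : ℕ → List Part → Bool
headFollows a [] = true
headFollows a (p ∷ _) = follows a p

chainOK-∷ : ∀ b y π → chainOK ((b , y) ∷ π) ≡ headFollows b π ∧ chainOK π
chainOK-∷ b y [] = refl
chainOK-∷ b y (p ∷ π) = refl

signOf-suc : ∀ m → signOf (suc m) ≡ - signOf m
signOf-suc zero = refl
signOf-suc (suc m) = trans (sym (ℤP.neg-involutive (signOf m))) (cong -_ (sym (signOf-suc m)))

sptTerm : ℕ → ℕ → List Part → ℤ
sptTerm k n π = if isOverpartition n π ∧ inSptko k π then signOf (partsAboveS π) else 0ℤ

smallestIs : ℕ → Maybe ℕ → Bool
smallestIs s nothing = false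
smallestIs s (just x) = x ≡ᵇ s

nonOverlinedAtLeast : ℕ → List Part → Bool
nonOverlinedAtLeast u = allᵇ (λ p → if proj₂ p then true else u ≤ᵇ proj₁ p)

allPositive : List Part → Bool
allPositive = allᵇ (λ p → 0 <ᵇ proj₁ p)

private
  just-injective : ∀ {x y : ℕ} → just x ≡ just y → x ≡ y
  just-injective refl = refl

  minMaybe≢nothing : ∀ b m → minMaybe b m ≢ nothing
  minMaybe≢nothing b nothing ()
  minMaybe≢nothing b (just x) ()

smallest-nothing⇒ : ∀ u π → smallestNonOverlined π ≡ nothing → nonOverlinedAtLeast u π ≡ true
smallest-nothing⇒ u [] e = refl
smallest-nothing⇒ u ((b , true) ∷ π) e = smallest-nothing⇒ u π e
smallest-nothing⇒ u ((b , false) ∷ π) e = ⊥-elim (minMaybe≢nothing b _ e)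

smallest-just⇒ : ∀ u x π → smallestNonOverlined π ≡ just x → u ≤ x → nonOverlinedAtLeast u π ≡ true
smallest-just⇒ u x ((b , true) ∷ π) e u≤x = smallest-just⇒ u x π e u≤x
smallest-just⇒ u x ((b , false) ∷ π) e u≤x with smallestNonOverlined π in e′
... | nothing rewrite just-injective (sym e) | ≤ᵇ-true u≤x = smallest-nothing⇒ u π e′
... | just x′ rewrite sym (just-injective e) | ≤ᵇ-true (ℕP.≤-trans u≤x (ℕP.m⊓n≤m b x′)) =
  smallest-just⇒ u x′ π e′ (ℕP.≤-trans u≤x (ℕP.m⊓n≤n b x′))

⇒smallest-≥ : ∀ u x π → nonOverlinedAtLeast u π ≡ true → smallestNonOverlined π ≡ just x → u ≤ x
⇒smallest-≥ u x ((b , true) ∷ π) g e = ⇒smallest-≥ u x π g e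
⇒smallest-≥ u x ((b , false) ∷ π) g e with smallestNonOverlined π in e′
... | nothing rewrite just-injective (sym e) = ≤ᵇ≡true⇒≤ (BoolP.∧-conicalˡ _ _ g)
... | just x′ rewrite sym (just-injective e) =
  ℕP.⊓-glb (≤ᵇ≡true⇒≤ (BoolP.∧-conicalˡ _ _ g)) (⇒smallest-≥ u x′ π (BoolP.∧-conicalʳ (u ≤ᵇ b) _ g) e′)

positive⇒smallest-≥1 : ∀ x π → allPositive π ≡ true → smallestNonOverlined π ≡ just x → 1 ≤ x
positive⇒smallest-≥1 x ((b , true) ∷ π) g e = positive⇒smallest-≥1 x π (BoolP.∧-conicalʳ (0 <ᵇ b) _ g) e
positive⇒smallest-≥1 x ((b , false) ∷ π) g e with smallestNonOverlined π in e′
... | nothing rewrite just-injective (sym e) = ≤ᵇ≡true⇒≤ (BoolP.∧-conicalˡ _ _ g)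
... | just x′ rewrite sym (just-injective e) =
  ℕP.⊓-glb (≤ᵇ≡true⇒≤ (BoolP.∧-conicalˡ _ _ g)) (positive⇒smallest-≥1 x′ π (BoolP.∧-conicalʳ (0 <ᵇ b) _ g) e′)

smallest-≤-size : ∀ x π → smallestNonOverlined π ≡ just x → x ≤ sizeSum π
smallest-≤-size x ((b , true) ∷ π) e = ℕP.≤-trans (smallest-≤-size x π e) (ℕP.m≤n+m (sizeSum π) b)
smallest-≤-size x ((b , false) ∷ π) e with smallestNonOverlined π
... | nothing rewrite just-injective (sym e) = ℕP.m≤m+n b (sizeSum π)
... | just x′ rewrite sym (just-injective e) = ℕP.≤-trans (ℕP.m⊓n≤m b x′) (ℕP.m≤m+n b (sizeSum π))

sptTerm-nothing : ∀ k n π → smallestNonOverlined π ≡ nothing → sptTerm k n π ≡ 0ℤ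
sptTerm-nothing k n π e with smallestNonOverlined π
sptTerm-nothing k n π refl | nothing rewrite BoolP.∧-zeroʳ (isOverpartition n π) = refl

module SmallestPart (s k : ℕ) where

  allowed : Part → Bool
  allowed (b , y) = ((b ≡ᵇ s) ∧ not y) ∨ validAbove s b

  count : List Part → ℕ
  count π = length (filterᵇ (λ p → proj₁ p ≡ᵇ s) π)

  sign : List Part → ℤ
  sign π = signOf (length (filterᵇ (λ p → s <ᵇ proj₁ p) π))

  overlinedAbove : List Part → Bool
  overlinedAbove = allᵇ (λ p → if proj₂ p then s <ᵇ proj₁ p else true)

  parityOK : List Part → Bool
  parityOK = allᵇ (λ p → (proj₁ p ≡ᵇ s) ∨ not (sameParity (proj₁ p) s))

  shapeOK : ℕ → ℕ → List Part → Bool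
  shapeOK a t π = allᵇ allowed π ∧ headFollows a π ∧ chainOK π ∧ (sizeSum π ≡ᵇ t)

  shapeOK-∷ : ∀ a t b y π →
    shapeOK a t ((b , y) ∷ π) ≡ (follows a (b , y) ∧ (b ≤ᵇ t)) ∧ (allowed (b , y) ∧ shapeOK b (t ∸ b) π)
  shapeOK-∷ a t b y π = begin
    (allowed (b , y) ∧ allᵇ allowed π) ∧ follows a (b , y) ∧ chainOK ((b , y) ∷ π) ∧ (b ℕ.+ sizeSum π ≡ᵇ t)
      ≡⟨ cong₂ (λ c z → (allowed (b , y) ∧ allᵇ allowed π) ∧ follows a (b , y) ∧ c ∧ z)
               (chainOK-∷ b y π) (+-≡ᵇ-split b (sizeSum π) t) ⟩
    (allowed (b , y) ∧ allᵇ allowed π) ∧ follows a (b , y) ∧ (headFollows b π ∧ chainOK π) ∧ ((b ≤ᵇ t) ∧ (sizeSum π ≡ᵇ t ∸ b))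
      ≡⟨ reorder (allowed (b , y)) (allᵇ allowed π) (follows a (b , y)) (headFollows b π) (chainOK π) (b ≤ᵇ t) (sizeSum π ≡ᵇ t ∸ b) ⟩
    (follows a (b , y) ∧ (b ≤ᵇ t)) ∧ (allowed (b , y) ∧ shapeOK b (t ∸ b) π) ∎
    where
    open ≡-Reasoning
    open CMSolver BoolP.∧-commutativeMonoid using (solve; _⊜_) renaming (_⊕_ to _∧ₑ_)
    reorder : ∀ al as f h c le sz → (al ∧ as) ∧ f ∧ (h ∧ c) ∧ (le ∧ sz) ≡ (f ∧ le) ∧ (al ∧ as ∧ h ∧ c ∧ sz)
    reorder = solve 7 (λ al as f h c le sz →
      (al ∧ₑ as) ∧ₑ f ∧ₑ (h ∧ₑ c) ∧ₑ (le ∧ₑ sz) ⊜ (f ∧ₑ le) ∧ₑ (al ∧ₑ as ∧ₑ h ∧ₑ c ∧ₑ sz)) refl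

  allowed-valid : ∀ b y → validAbove s b ≡ true → allowed (b , y) ≡ true
  allowed-valid b y v rewrite v = BoolP.∨-zeroʳ _

  allowed-invalid : ∀ b y → validAbove s b ≡ false → allowed (b , y) ≡ (b ≡ᵇ s) ∧ not y
  allowed-invalid b y v rewrite v = BoolP.∨-identityʳ _

  follows-s⇒invalid : ∀ b y → follows s (b , y) ≡ true → validAbove s b ≡ false
  follows-s⇒invalid b y f with ℕP.<-cmp s b
  ... | tri< s<b _ _ rewrite <ᵇ-false {b} {s} (ℕP.<⇒≤ s<b) | ≡ᵇ-false {s} {b} (ℕP.<⇒≢ s<b) = case f of λ ()
  ... | tri≈ _ refl _ rewrite <ᵇ-false {s} {s} ℕP.≤-refl = refl
  ... | tri> _ _ b<s rewrite <ᵇ-false {s} {b} (ℕP.<⇒≤ b<s) = refl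

  count-∷-≢ : ∀ b y π → (b ≡ᵇ s) ≡ false → count ((b , y) ∷ π) ≡ count π
  count-∷-≢ b y π b≢s rewrite b≢s = refl

  sign-∷-> : ∀ b y π → (s <ᵇ b) ≡ true → sign ((b , y) ∷ π) ≡ - sign π
  sign-∷-> b y π s<b rewrite s<b = signOf-suc (length (filterᵇ (λ p → s <ᵇ proj₁ p) π))

  sign-∷-s : ∀ y π → sign ((s , y) ∷ π) ≡ sign π
  sign-∷-s y π rewrite <ᵇ-false {s} {s} ℕP.≤-refl = refl

  -- The phases of reading a canonical list from left to right: first the parts
  -- above s (the last one read is remembered), then the copies of s still due.
  data Phase : Set where
    above  : ℕ → Phase
    copies : ℕ → Phase

  bound : Phase → ℕ
  bound (above a) = a
  bound (copies _) = s

  pending : Phase → ℕ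
  pending (above _) = k
  pending (copies r) = r

  tailOK : Phase → ℕ → List Part → Bool
  tailOK φ t π = shapeOK (bound φ) t π ∧ (count π ≡ᵇ pending φ)

  mutual
    weight : Phase → ℕ → List Part → ℤ
    weight φ t [] = 𝟙 ((0 ≡ᵇ t) ∧ (0 ≡ᵇ pending φ))
    weight φ t ((b , y) ∷ π) = if follows (bound φ) (b , y) ∧ (b ≤ᵇ t) then read φ b y (t ∸ b) π else 0ℤ

    read : Phase → ℕ → Bool → ℕ → List Part → ℤ
    read (above a) b y t π = if validAbove s b then - weight (above b) t π else readS k b y t π
    read (copies r) b y t π = readS r b y t π

    readS : ℕ → ℕ → Bool → ℕ → List Part → ℤ
    readS zero b y t π = 0ℤ
    readS (suc r) b y t π = if (b ≡ᵇ s) ∧ not y then weight (copies r) t π else 0ℤ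

  tailOK-∷ : ∀ φ t b y π → tailOK φ t ((b , y) ∷ π) ≡
    (follows (bound φ) (b , y) ∧ (b ≤ᵇ t)) ∧ ((allowed (b , y) ∧ shapeOK b (t ∸ b) π) ∧ (count ((b , y) ∷ π) ≡ᵇ pending φ))
  tailOK-∷ φ t b y π =
    trans (cong (_∧ (count ((b , y) ∷ π) ≡ᵇ pending φ)) (shapeOK-∷ (bound φ) t b y π))
          (BoolP.∧-assoc (follows (bound φ) (b , y) ∧ (b ≤ᵇ t)) (allowed (b , y) ∧ shapeOK b (t ∸ b) π) _)

  mutual
    weight≡tailOK : ∀ φ t π → weight φ t π ≡ (if tailOK φ t π then sign π else 0ℤ)
    weight≡tailOK φ t [] = refl
    weight≡tailOK φ t ((b , y) ∷ π) = begin
      (if follows (bound φ) (b , y) ∧ (b ≤ᵇ t) then read φ b y (t ∸ b) π else 0ℤ)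
        ≡⟨ readOK (follows (bound φ) (b , y)) refl (b ≤ᵇ t) ⟩
      (if follows (bound φ) (b , y) ∧ (b ≤ᵇ t) then (if R then sign ((b , y) ∷ π) else 0ℤ) else 0ℤ)
        ≡⟨ if-∧ (follows (bound φ) (b , y) ∧ (b ≤ᵇ t)) R _ _ ⟨
      (if (follows (bound φ) (b , y) ∧ (b ≤ᵇ t)) ∧ R then sign ((b , y) ∷ π) else 0ℤ)
        ≡⟨ cong (λ c → if c then sign ((b , y) ∷ π) else 0ℤ) (tailOK-∷ φ t b y π) ⟨
      (if tailOK φ t ((b , y) ∷ π) then sign ((b , y) ∷ π) else 0ℤ) ∎
      where
      open ≡-Reasoning
      R = (allowed (b , y) ∧ shapeOK b (t ∸ b) π) ∧ (count ((b , y) ∷ π) ≡ᵇ pending φ)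
      readOK : ∀ f → follows (bound φ) (b , y) ≡ f → ∀ le →
        (if f ∧ le then read φ b y (t ∸ b) π else 0ℤ) ≡ (if f ∧ le then (if R then sign ((b , y) ∷ π) else 0ℤ) else 0ℤ)
      readOK false _ le = refl
      readOK true _ false = refl
      readOK true f≡ true = read≡tailOK φ b y (t ∸ b) π f≡

    read≡tailOK : ∀ φ b y t π → follows (bound φ) (b , y) ≡ true →
      read φ b y t π ≡ (if (allowed (b , y) ∧ shapeOK b t π) ∧ (count ((b , y) ∷ π) ≡ᵇ pending φ) then sign ((b , y) ∷ π) else 0ℤ)
    read≡tailOK (above a) b y t π _ = readAbove (validAbove s b) refl
      where
      open ≡-Reasoning
      RHS = if (allowed (b , y) ∧ shapeOK b t π) ∧ (count ((b , y) ∷ π) ≡ᵇ k) then sign ((b , y) ∷ π) else 0ℤ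
      readAbove : ∀ v → validAbove s b ≡ v → (if v then - weight (above b) t π else readS k b y t π) ≡ RHS
      readAbove false v rewrite allowed-invalid b y v = readS≡tailOK k b y t π
      readAbove true v = begin
        - weight (above b) t π                                          ≡⟨ cong -_ (weight≡tailOK (above b) t π) ⟩
        - (if shapeOK b t π ∧ (count π ≡ᵇ k) then sign π else 0ℤ)       ≡⟨ neg-if _ (sign π) ⟩
        (if shapeOK b t π ∧ (count π ≡ᵇ k) then - sign π else 0ℤ)       ≡⟨ cong₂ (λ c z → if c then z else 0ℤ)
                                                                             (cong₂ _∧_ (cong (_∧ shapeOK b t π) (allowed-valid b y v))
                                                                                        (cong (_≡ᵇ k) (count-∷-≢ b y π b≢s)))
                                                                             (sign-∷-> b y π (<ᵇ-true s<b)) ⟨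
        RHS                                                             ∎
        where
        s<b : s < b
        s<b = validAbove⇒> v
        b≢s : (b ≡ᵇ s) ≡ false
        b≢s = ≡ᵇ-false (ℕP.>⇒≢ s<b)
    read≡tailOK (copies r) b y t π f rewrite allowed-invalid b y (follows-s⇒invalid b y f) = readS≡tailOK r b y t π

    readS≡tailOK : ∀ r b y t π →
      readS r b y t π ≡ (if (((b ≡ᵇ s) ∧ not y) ∧ shapeOK b t π) ∧ (count ((b , y) ∷ π) ≡ᵇ r) then sign ((b , y) ∷ π) else 0ℤ)
    readS≡tailOK zero b y t π with b ≡ᵇ s | ≡ᵇ-reflects-≡ b s | y
    ... | false | _ | _ = refl
    ... | true | _ | true = refl
    ... | true | ofʸ refl | false = sym (cong (λ c → if c then sign ((s , false) ∷ π) else 0ℤ) (BoolP.∧-zeroʳ (true ∧ shapeOK s t π)))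
    readS≡tailOK (suc r) b y t π with b ≡ᵇ s | ≡ᵇ-reflects-≡ b s | y
    ... | false | _ | _ = refl
    ... | true | _ | true = refl
    ... | true | ofʸ refl | false =
      trans (weight≡tailOK (copies r) t π) (cong (λ z → if tailOK (copies r) t π then z else 0ℤ) (sym (sign-∷-s false π)))

  allowed-s : ∀ y → allowed (s , y) ≡ not y
  allowed-s y rewrite ≡ᵇ-refl s | <ᵇ-false {s} {s} ℕP.≤-refl = BoolP.∨-identityʳ (not y)

  allowed-≢ : ∀ b y → (b ≡ᵇ s) ≡ false → allowed (b , y) ≡ validAbove s b
  allowed-≢ b y b≢s rewrite b≢s = refl

  allowed⇒≥ : ∀ b → allowed (b , false) ≡ true → (s ≤ᵇ b) ≡ true
  allowed⇒≥ b al with b ≡ᵇ s | ≡ᵇ-reflects-≡ b s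
  ... | true | ofʸ refl = ≤ᵇ-true (ℕP.≤-refl {b})
  ... | false | _ = ≤ᵇ-true (ℕP.<⇒≤ (validAbove⇒> {s} {b} al))

  all-allowed⇒≥ : ∀ π → allᵇ allowed π ≡ true → nonOverlinedAtLeast s π ≡ true
  all-allowed⇒≥ [] _ = refl
  all-allowed⇒≥ ((b , true) ∷ π) al = all-allowed⇒≥ π (BoolP.∧-conicalʳ (allowed (b , true)) _ al)
  all-allowed⇒≥ ((b , false) ∷ π) al =
    cong₂ _∧_ (allowed⇒≥ b (BoolP.∧-conicalˡ _ _ al)) (all-allowed⇒≥ π (BoolP.∧-conicalʳ (allowed (b , false)) _ al))

  count≥1⇒smallest : ∀ π → allᵇ allowed π ≡ true → 1 ≤ count π → smallestNonOverlined π ≡ just s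
  count≥1⇒smallest ((b , y) ∷ π) al c with b ℕP.≟ s
  ... | yes refl = copyOfS y al
    where
    copyOfS : ∀ y → allowed (s , y) ∧ allᵇ allowed π ≡ true → smallestNonOverlined ((s , y) ∷ π) ≡ just s
    copyOfS true al = case trans (sym (allowed-s true)) (BoolP.∧-conicalˡ _ _ al) of λ ()
    copyOfS false al with smallestNonOverlined π in e
    ... | nothing = refl
    ... | just x = cong just (ℕP.m≤n⇒m⊓n≡m (⇒smallest-≥ s x π (all-allowed⇒≥ π (BoolP.∧-conicalʳ _ _ al)) e))
  ... | no b≢s = partAbove y
    where
    b≢ᵇs = ≡ᵇ-false b≢s
    IH : smallestNonOverlined π ≡ just s
    IH = count≥1⇒smallest π (BoolP.∧-conicalʳ (allowed (b , y)) _ al) (subst (1 ≤_) (count-∷-≢ b y π b≢ᵇs) c)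
    s≤b : s ≤ b
    s≤b = ℕP.<⇒≤ (validAbove⇒> (trans (sym (allowed-≢ b y b≢ᵇs)) (BoolP.∧-conicalˡ _ _ al)))
    partAbove : ∀ y → smallestNonOverlined ((b , y) ∷ π) ≡ just s
    partAbove true = IH
    partAbove false rewrite IH = cong just (ℕP.m≥n⇒m⊓n≡n s≤b)

  tailOK-false : 1 ≤ k → ∀ φ t π → smallestNonOverlined π ≢ just s → pending φ ≡ k → tailOK φ t π ≡ false
  tailOK-false 1≤k φ t π ≢s pk with tailOK φ t π in ok
  ... | false = refl
  ... | true = ⊥-elim (≢s (count≥1⇒smallest π al (subst (1 ≤_) (sym cnt) 1≤k)))
    where
    al : allᵇ allowed π ≡ true
    al = BoolP.∧-conicalˡ _ _ (BoolP.∧-conicalˡ _ _ ok)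
    cnt : count π ≡ k
    cnt = trans (≡ᵇ≡true⇒≡ (BoolP.∧-conicalʳ (shapeOK (bound φ) t π) _ ok)) pk

  sptTerm-smallest : ∀ n π → smallestNonOverlined π ≡ just s →
    sptTerm k n π ≡ (if isOverpartition n π ∧ ((count π ≡ᵇ k) ∧ overlinedAbove π ∧ parityOK π) then sign π else 0ℤ)
  sptTerm-smallest n π e with smallestNonOverlined π
  sptTerm-smallest n π refl | just .s = refl

  module _ (1≤s : 1 ≤ s) where

    allowed-iff : ∀ b y → (if y then true else s ≤ᵇ b) ≡ true →
      allowed (b , y) ≡ (0 <ᵇ b) ∧ (if y then s <ᵇ b else true) ∧ ((b ≡ᵇ s) ∨ not (sameParity b s))
    allowed-iff b y geh with ℕP.<-cmp b s
    ... | tri< b<s _ _ rewrite ≡ᵇ-false (ℕP.<⇒≢ b<s) | <ᵇ-false {s} {b} (ℕP.<⇒≤ b<s) = below b y b<s geh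
      where
      below : ∀ b y → b < s → (if y then true else s ≤ᵇ b) ≡ true →
        false ≡ (0 <ᵇ b) ∧ (if y then false else true) ∧ not (sameParity b s)
      below b false b<s geh = ⊥-elim (ℕP.<⇒≱ b<s (≤ᵇ≡true⇒≤ geh))
      below zero true _ _ = refl
      below (suc b) true _ _ = refl
    ... | tri≈ _ refl _ rewrite ≡ᵇ-refl s | <ᵇ-false {s} {s} ℕP.≤-refl | <ᵇ-true 1≤s = atS y
      where
      atS : ∀ y → not y ∨ false ≡ (if y then false else true) ∧ true
      atS true = refl
      atS false = refl
    ... | tri> _ _ s<b rewrite ≡ᵇ-false (ℕP.>⇒≢ s<b) | <ᵇ-true s<b | <ᵇ-true (ℕP.≤-<-trans z≤n s<b) = aboveS y
      where
      aboveS : ∀ y → not (sameParity b s) ≡ (if y then true else true) ∧ not (sameParity b s)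
      aboveS true = refl
      aboveS false = refl

    all-allowed-iff : ∀ π → nonOverlinedAtLeast s π ≡ true →
      allᵇ allowed π ≡ allPositive π ∧ overlinedAbove π ∧ parityOK π
    all-allowed-iff [] _ = refl
    all-allowed-iff ((b , y) ∷ π) ge = begin
      allowed (b , y) ∧ allᵇ allowed π
        ≡⟨ cong₂ _∧_ (allowed-iff b y (BoolP.∧-conicalˡ _ _ ge)) (all-allowed-iff π (BoolP.∧-conicalʳ _ _ ge)) ⟩
      (pos ∧ ov ∧ par) ∧ (allPositive π ∧ overlinedAbove π ∧ parityOK π)
        ≡⟨ interleave pos ov par (allPositive π) (overlinedAbove π) (parityOK π) ⟩
      (pos ∧ allPositive π) ∧ (ov ∧ overlinedAbove π) ∧ (par ∧ parityOK π) ∎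
      where
      open ≡-Reasoning
      open CMSolver BoolP.∧-commutativeMonoid using (solve; _⊜_) renaming (_⊕_ to _∧ₑ_)
      pos = 0 <ᵇ b
      ov = if y then s <ᵇ b else true
      par = (b ≡ᵇ s) ∨ not (sameParity b s)
      interleave : ∀ a b c d e f → (a ∧ b ∧ c) ∧ (d ∧ e ∧ f) ≡ (a ∧ d) ∧ (b ∧ e) ∧ (c ∧ f)
      interleave = solve 6 (λ a b c d e f → (a ∧ₑ b ∧ₑ c) ∧ₑ (d ∧ₑ e ∧ₑ f) ⊜ (a ∧ₑ d) ∧ₑ (b ∧ₑ e) ∧ₑ (c ∧ₑ f)) refl

    size⇒headFollows : ∀ n π → (sizeSum π ≡ᵇ n) ≡ true → headFollows (suc n) π ≡ true
    size⇒headFollows n [] _ = refl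
    size⇒headFollows n ((b , y) ∷ π) size≡n
      rewrite <ᵇ-true (s≤s (ℕP.≤-trans (ℕP.m≤m+n b (sizeSum π)) (ℕP.≤-reflexive (≡ᵇ≡true⇒≡ size≡n)))) = refl

    tailOK≡spt : ∀ n π → smallestNonOverlined π ≡ just s →
      tailOK (above (suc n)) n π ≡ isOverpartition n π ∧ ((count π ≡ᵇ k) ∧ overlinedAbove π ∧ parityOK π)
    tailOK≡spt n π smallest≡s = begin
      (allᵇ allowed π ∧ hf ∧ ch ∧ sz) ∧ cn
        ≡⟨ cong (λ c → (c ∧ hf ∧ ch ∧ sz) ∧ cn) (all-allowed-iff π (smallest-just⇒ s s π smallest≡s ℕP.≤-refl)) ⟩
      ((pos ∧ ov ∧ par) ∧ hf ∧ ch ∧ sz) ∧ cn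
        ≡⟨ pull pos ov par hf ch sz cn ⟩
      sz ∧ hf ∧ (pos ∧ ch ∧ cn ∧ ov ∧ par)
        ≡⟨ absorb sz hf _ (size⇒headFollows n π) ⟩
      sz ∧ (pos ∧ ch ∧ cn ∧ ov ∧ par)
        ≡⟨ push pos ov par ch sz cn ⟩
      (pos ∧ sz ∧ ch) ∧ (cn ∧ ov ∧ par) ∎
      where
      open ≡-Reasoning
      open CMSolver BoolP.∧-commutativeMonoid using (solve; _⊜_) renaming (_⊕_ to _∧ₑ_)
      pos = allPositive π
      ov = overlinedAbove π
      par = parityOK π
      hf = headFollows (suc n) π
      ch = chainOK π
      sz = sizeSum π ≡ᵇ n
      cn = count π ≡ᵇ k
      pull : ∀ pos ov par hf ch sz cn → ((pos ∧ ov ∧ par) ∧ hf ∧ ch ∧ sz) ∧ cn ≡ sz ∧ hf ∧ (pos ∧ ch ∧ cn ∧ ov ∧ par)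
      pull = solve 7 (λ pos ov par hf ch sz cn →
        ((pos ∧ₑ ov ∧ₑ par) ∧ₑ hf ∧ₑ ch ∧ₑ sz) ∧ₑ cn ⊜ sz ∧ₑ hf ∧ₑ (pos ∧ₑ ch ∧ₑ cn ∧ₑ ov ∧ₑ par)) refl
      push : ∀ pos ov par ch sz cn → sz ∧ (pos ∧ ch ∧ cn ∧ ov ∧ par) ≡ (pos ∧ sz ∧ ch) ∧ (cn ∧ ov ∧ par)
      push = solve 6 (λ pos ov par ch sz cn →
        sz ∧ₑ (pos ∧ₑ ch ∧ₑ cn ∧ₑ ov ∧ₑ par) ⊜ (pos ∧ₑ sz ∧ₑ ch) ∧ₑ (cn ∧ₑ ov ∧ₑ par)) refl
      absorb : ∀ a h x → (a ≡ true → h ≡ true) → a ∧ h ∧ x ≡ a ∧ x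
      absorb false h x _ = refl
      absorb true h x a⇒h rewrite a⇒h refl = refl

    weight≡sptTerm : 1 ≤ k → ∀ n π →
      weight (above (suc n)) n π ≡ (if smallestIs s (smallestNonOverlined π) then sptTerm k n π else 0ℤ)
    weight≡sptTerm 1≤k n π = trans (weight≡tailOK (above (suc n)) n π) (bySmallest (smallestNonOverlined π) refl)
      where
      notS : smallestNonOverlined π ≢ just s → (if tailOK (above (suc n)) n π then sign π else 0ℤ) ≡ 0ℤ
      notS ≢s rewrite tailOK-false 1≤k (above (suc n)) n π ≢s refl = refl
      bySmallest : ∀ m → smallestNonOverlined π ≡ m →
        (if tailOK (above (suc n)) n π then sign π else 0ℤ) ≡ (if smallestIs s m then sptTerm k n π else 0ℤ)
      bySmallest nothing e = notS (λ e′ → case trans (sym e) e′ of λ ())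
      bySmallest (just x) e with x ℕP.≟ s
      ... | no x≢s rewrite ≡ᵇ-false x≢s = notS (λ e′ → x≢s (just-injective (trans (sym e) e′)))
      ... | yes refl rewrite ≡ᵇ-refl x | sptTerm-smallest n π e =
        cong (λ c → if c then sign π else 0ℤ) (tailOK≡spt n π e)

sptTerm-by-smallest : ∀ k n π → sptTerm k n π ≡ ∑[ j < n ] (if smallestIs (suc j) (smallestNonOverlined π) then sptTerm k n π else 0ℤ)
sptTerm-by-smallest k n π = sym (bySmallest (smallestNonOverlined π) refl)
  where
  T = sptTerm k n π
  bySmallest : ∀ m → smallestNonOverlined π ≡ m → ∑[ j < n ] (if smallestIs (suc j) m then T else 0ℤ) ≡ T
  bySmallest nothing e = trans (∑<-0 n) (sym (sptTerm-nothing k n π e))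
  bySmallest (just zero) e with allPositive π in pos
  ... | true = ⊥-elim (ℕP.<-irrefl refl (positive⇒smallest-≥1 0 π pos e))
  ... | false = ∑<-0 n
  bySmallest (just (suc x)) e = begin
    ∑[ j < n ] (if x ≡ᵇ j then T else 0ℤ)  ≡⟨ ∑<-cong n (λ j _ → if≡𝟙* (x ≡ᵇ j) T) ⟩
    ∑[ j < n ] (𝟙 (x ≡ᵇ j) * T)            ≡⟨ ∑<-select n x (λ _ → T) ⟩
    𝟙 (x <ᵇ n) * T                         ≡⟨ inRange ⟩
    T                                      ∎
    where
    open ≡-Reasoning
    inRange : 𝟙 (x <ᵇ n) * T ≡ T
    inRange with x <ᵇ n | ℕP.<ᵇ-reflects-< x n
    ... | true | _ = ℤP.*-identityˡ T
    ... | false | ofⁿ x≮n with sizeSum π ≡ᵇ n in size≡n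
    ...   | true = ⊥-elim (x≮n (ℕP.≤-trans (smallest-≤-size (suc x) π e) (ℕP.≤-reflexive (≡ᵇ≡true⇒≡ size≡n))))
    ...   | false rewrite BoolP.∧-zeroʳ (allPositive π) = refl

-- Signed generating functions of the lists that may follow a part of size a: parts below a, resp. at
-- most a (with a itself non-overlined), followed by the k copies of s.
module GeneratingSeries (s k : ℕ) where

  tailsBelow : ℕ → Series
  tailsBelow a = X^ (k ℕ.* s) ⊛ pochRatio s a

  tailsAtMost : ℕ → Series
  tailsAtMost a = tailsBelow a ⊛ inv (factor (- 1ℤ) a)

  tailsAfter : ℕ → Series
  tailsAfter a = if validAbove s a then tailsAtMost a else tailsBelow a

  firstPartCoeff : ℕ → ℕ → ℤ
  firstPartCoeff a t = if validAbove s a then - (X^ a ⊛ tailsAtMost a) t else 0ℤ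

  firstPartCoeff-vanish : ∀ {a t} → t < a → firstPartCoeff a t ≡ 0ℤ
  firstPartCoeff-vanish {a} {t} t<a with validAbove s a
  ... | true = cong -_ (mono-⊛-coeff-< 1ℤ a (tailsAtMost a) t t<a)
  ... | false = refl

  tailsAfter-valid : ∀ {a} → validAbove s a ≡ true → tailsAfter a ≡ tailsAtMost a
  tailsAfter-valid v rewrite v = refl

  tailsAfter-invalid : ∀ {a} → validAbove s a ≡ false → tailsAfter a ≡ tailsBelow a
  tailsAfter-invalid v rewrite v = refl

  firstPartCoeff-valid : ∀ {a t} → validAbove s a ≡ true → firstPartCoeff a t ≡ - (X^ a ⊛ tailsAtMost a) t
  firstPartCoeff-valid v rewrite v = refl

  firstPartCoeff-invalid : ∀ {a t} → validAbove s a ≡ false → firstPartCoeff a t ≡ 0ℤ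
  firstPartCoeff-invalid v rewrite v = refl

  tailsBelow-coeff : ∀ a t → tailsBelow a t ≡ 𝟙 (t ≡ᵇ k ℕ.* s) + ∑[ b < a ] (firstPartCoeff b t + firstPartCoeff b t)
  tailsBelow-coeff zero t = trans (coeff (⊛-identityʳ (X^ (k ℕ.* s))) t) (sym (ℤP.+-identityʳ _))
  tailsBelow-coeff (suc a) t = begin
    tailsBelow (suc a) t
      ≡⟨ lastFactor (validAbove s a) refl ⟩
    tailsBelow a t + (firstPartCoeff a t + firstPartCoeff a t)
      ≡⟨ cong (_+ (firstPartCoeff a t + firstPartCoeff a t)) (tailsBelow-coeff a t) ⟩
    𝟙 (t ≡ᵇ k ℕ.* s) + ∑[ b < a ] (firstPartCoeff b t + firstPartCoeff b t) + (firstPartCoeff a t + firstPartCoeff a t)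
      ≡⟨ ℤP.+-assoc (𝟙 (t ≡ᵇ k ℕ.* s)) _ _ ⟩
    𝟙 (t ≡ᵇ k ℕ.* s) + (∑[ b < a ] (firstPartCoeff b t + firstPartCoeff b t) + (firstPartCoeff a t + firstPartCoeff a t))
      ≡⟨ cong (𝟙 (t ≡ᵇ k ℕ.* s) +_) (∑<-suc a (λ b → firstPartCoeff b t + firstPartCoeff b t)) ⟨
    𝟙 (t ≡ᵇ k ℕ.* s) + ∑[ b < suc a ] (firstPartCoeff b t + firstPartCoeff b t) ∎
    where
    open ≡-Reasoning
    double : ∀ x → - (ℤ.+ 2 * x) ≡ - x + - x
    double = solve-∀
    lastFactor : ∀ v → validAbove s a ≡ v → tailsBelow (suc a) t ≡ tailsBelow a t + (firstPartCoeff a t + firstPartCoeff a t)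
    lastFactor false v = begin
      tailsBelow (suc a) t                    ≡⟨ cong (λ P → (X^ (k ℕ.* s) ⊛ P) t) (pochRatio-invalid {s} {a} v) ⟩
      tailsBelow a t                          ≡⟨ ℤP.+-identityʳ (tailsBelow a t) ⟨
      tailsBelow a t + 0ℤ                     ≡⟨ cong (tailsBelow a t +_)
                                                      (cong₂ _+_ (firstPartCoeff-invalid {a} {t} v) (firstPartCoeff-invalid {a} {t} v)) ⟨
      tailsBelow a t + (firstPartCoeff a t + firstPartCoeff a t)  ∎
    lastFactor true v = begin
      tailsBelow (suc a) t
        ≡⟨ cong (λ P → (X^ (k ℕ.* s) ⊛ P) t) (pochRatio-valid {s} {a} v) ⟩
      (X^ (k ℕ.* s) ⊛ (pochRatio s a ⊛ ratioFactor a)) t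
        ≡⟨ coeff (≋-trans (≋-sym (⊛-assoc (X^ (k ℕ.* s)) (pochRatio s a) (ratioFactor a)))
                          (⊛-ratioFactor a (ℕP.≤-<-trans z≤n (validAbove⇒> v)) (tailsBelow a))) t ⟩
      tailsBelow a t + - (constS (ℤ.+ 2) ⊛ (X^ a ⊛ tailsAtMost a)) t
        ≡⟨ cong (λ x → tailsBelow a t + - x) (coeff (constS-⊛ (ℤ.+ 2) (X^ a ⊛ tailsAtMost a)) t) ⟩
      tailsBelow a t + - (ℤ.+ 2 * (X^ a ⊛ tailsAtMost a) t)
        ≡⟨ cong (tailsBelow a t +_) (trans (double _) (cong₂ _+_ (sym (firstPartCoeff-valid {a} {t} v)) (sym (firstPartCoeff-valid {a} {t} v)))) ⟩
      tailsBelow a t + (firstPartCoeff a t + firstPartCoeff a t) ∎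

  tailsAfter-coeff : ∀ a t → tailsAfter a t ≡ tailsBelow a t + firstPartCoeff a t
  tailsAfter-coeff a t = byValidity (validAbove s a) refl
    where
    byValidity : ∀ v → validAbove s a ≡ v → tailsAfter a t ≡ tailsBelow a t + firstPartCoeff a t
    byValidity false v = trans (cong (λ f → f t) (tailsAfter-invalid {a} v))
                               (sym (trans (cong (tailsBelow a t +_) (firstPartCoeff-invalid {a} {t} v)) (ℤP.+-identityʳ (tailsBelow a t))))
    byValidity true v = trans (cong (λ f → f t) (tailsAfter-valid {a} v))
                              (trans (coeff (⊛-inv-1+X^ a (ℕP.≤-<-trans z≤n (validAbove⇒> v)) (tailsBelow a)) t)
                                     (cong (tailsBelow a t +_) (sym (firstPartCoeff-valid {a} {t} v))))

module Enumeration (n : ℕ) where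

  enum : ℕ → (List Part → ℤ) → ℤ
  enum L = ∑ (listsUpTo L (alphabet n))

  enum-0 : ∀ f → enum 0 f ≡ f []
  enum-0 f = ℤP.+-identityʳ (f [])

  enum-suc : ∀ L f → enum (suc L) f ≡
    f [] + ∑[ b < suc n ] (enum L (λ π → f ((b , false) ∷ π)) + enum L (λ π → f ((b , true) ∷ π)))
  enum-suc L f = cong (f [] +_) (begin
    ∑ (concatMap (λ a → map (a ∷_) lists) (alphabet n)) f
      ≡⟨ ∑-concatMap (λ a → map (a ∷_) lists) (alphabet n) f ⟩
    ∑[ a ∈ alphabet n ] ∑ (map (a ∷_) lists) f
      ≡⟨ ∑-cong (alphabet n) (λ a → ∑-map (a ∷_) lists f) ⟩
    ∑[ a ∈ alphabet n ] enum L (f ∘ (a ∷_))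
      ≡⟨ ∑-concatMap (λ b → (b , false) ∷ (b , true) ∷ []) (upTo (suc n)) (λ p → enum L (f ∘ (p ∷_))) ⟩
    ∑[ b ∈ upTo (suc n) ] (enum L (f ∘ ((b , false) ∷_)) + (enum L (f ∘ ((b , true) ∷_)) + 0ℤ))
      ≡⟨ ∑-cong (upTo (suc n)) (λ b → cong (enum L (f ∘ ((b , false) ∷_)) +_) (ℤP.+-identityʳ (enum L (f ∘ ((b , true) ∷_))))) ⟩
    ∑[ b ∈ upTo (suc n) ] (enum L (f ∘ ((b , false) ∷_)) + enum L (f ∘ ((b , true) ∷_)))
      ≡⟨ ∑-upTo (suc n) (λ b → enum L (f ∘ ((b , false) ∷_)) + enum L (f ∘ ((b , true) ∷_))) ⟩
    ∑[ b < suc n ] (enum L (f ∘ ((b , false) ∷_)) + enum L (f ∘ ((b , true) ∷_))) ∎)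
    where
    open ≡-Reasoning
    lists = listsUpTo L (alphabet n)

  enum-∑< : ∀ L m (F : ℕ → List Part → ℤ) → enum L (λ π → ∑[ j < m ] F j π) ≡ ∑[ j < m ] enum L (F j)
  enum-∑< L zero F = ∑-0 (listsUpTo L (alphabet n))
  enum-∑< L (suc m) F = trans (∑-distrib-+ (listsUpTo L (alphabet n)) (F 0) (λ π → ∑[ j < m ] F (suc j) π))
                              (cong (enum L (F 0) +_) (enum-∑< L m (F ∘ suc)))

𝟙-<ᵇ-suc : ∀ b a → 𝟙 (b <ᵇ suc a) ≡ 𝟙 (b <ᵇ a) + 𝟙 (a ≡ᵇ b)
𝟙-<ᵇ-suc zero zero = refl
𝟙-<ᵇ-suc zero (suc a) = refl
𝟙-<ᵇ-suc (suc b) zero = refl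
𝟙-<ᵇ-suc (suc b) (suc a) = 𝟙-<ᵇ-suc b a

∑<-𝟙<ᵇ : ∀ m a (g : ℕ → ℤ) → (∀ b → m ≤ b → g b ≡ 0ℤ) → ∑[ b < m ] (𝟙 (b <ᵇ a) * g b) ≡ ∑[ b < a ] g b
∑<-𝟙<ᵇ m zero g _ = ∑<-0 m
∑<-𝟙<ᵇ m (suc a) g g≥m≡0 = begin
  ∑[ b < m ] (𝟙 (b <ᵇ suc a) * g b)                          ≡⟨ ∑<-cong m (λ b _ → trans (cong (_* g b) (𝟙-<ᵇ-suc b a))
                                                                                   (ℤP.*-distribʳ-+ (g b) (𝟙 (b <ᵇ a)) _)) ⟩
  ∑[ b < m ] (𝟙 (b <ᵇ a) * g b + 𝟙 (a ≡ᵇ b) * g b)          ≡⟨ ∑<-distrib-+ m _ _ ⟩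
  ∑[ b < m ] (𝟙 (b <ᵇ a) * g b) + ∑[ b < m ] (𝟙 (a ≡ᵇ b) * g b)
                                                             ≡⟨ cong₂ _+_ (∑<-𝟙<ᵇ m a g g≥m≡0) (∑<-select m a g) ⟩
  ∑[ b < a ] g b + 𝟙 (a <ᵇ m) * g a                          ≡⟨ cong (∑[ b < a ] g b +_) lastTerm ⟩
  ∑[ b < a ] g b + g a                                       ≡⟨ ∑<-suc a g ⟨
  ∑[ b < suc a ] g b                                         ∎
  where
  open ≡-Reasoning
  lastTerm : 𝟙 (a <ᵇ m) * g a ≡ g a
  lastTerm with a <ᵇ m | ℕP.<ᵇ-reflects-< a m
  ... | true | _ = ℤP.*-identityˡ (g a)
  ... | false | ofⁿ a≮m = sym (g≥m≡0 a (ℕP.≮⇒≥ a≮m))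

follows-count : ∀ a b → 𝟙 (follows a (b , false)) + 𝟙 (follows a (b , true)) ≡ 𝟙 (b <ᵇ a) * ℤ.+ 2 + 𝟙 (a ≡ᵇ b)
follows-count a b with ℕP.<-cmp b a
... | tri< b<a _ _ rewrite <ᵇ-true b<a | ≡ᵇ-false (ℕP.>⇒≢ b<a) = refl
... | tri≈ _ refl _ rewrite <ᵇ-false {b} {b} ℕP.≤-refl | ≡ᵇ-refl b = refl
... | tri> _ _ a<b rewrite <ᵇ-false (ℕP.<⇒≤ a<b) | ≡ᵇ-false (ℕP.<⇒≢ a<b) = refl

module Counting (n s k : ℕ) (1≤s : 1 ≤ s) (s≤n : s ≤ n) where
  open SmallestPart s k
  open GeneratingSeries s k
  open Enumeration n

  private
    lists : ℕ → List (List Part)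
    lists L = listsUpTo L (alphabet n)

  startingWith : ℕ → Phase → ℕ → ℕ → Bool → ℤ
  startingWith L φ t b y = if follows (bound φ) (b , y) ∧ (b ≤ᵇ t) then enum L (read φ b y (t ∸ b)) else 0ℤ

  enum-weight-suc : ∀ L φ t → enum (suc L) (weight φ t) ≡
    weight φ t [] + ∑[ b < suc n ] (startingWith L φ t b false + startingWith L φ t b true)
  enum-weight-suc L φ t = trans (enum-suc L (weight φ t)) (cong (weight φ t [] +_) (∑<-cong (suc n) λ b _ →
    cong₂ _+_ (∑-if (lists L) (follows (bound φ) (b , false) ∧ (b ≤ᵇ t)) (read φ b false (t ∸ b)))
              (∑-if (lists L) (follows (bound φ) (b , true) ∧ (b ≤ᵇ t)) (read φ b true (t ∸ b)))))

  enum-readS-other : ∀ L r b y t → ((b ≡ᵇ s) ∧ not y) ≡ false → enum L (readS r b y t) ≡ 0ℤ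
  enum-readS-other L zero b y t _ = ∑-0 (lists L)
  enum-readS-other L (suc r) b y t e rewrite e = ∑-0 (lists L)

  startingWithS : ℕ → ℕ → ℕ → ℤ
  startingWithS L r t = if s ≤ᵇ t then enum L (readS r s false (t ∸ s)) else 0ℤ

  copiesAfterS : ℕ → ℕ → ℤ
  copiesAfterS zero t = 0ℤ
  copiesAfterS (suc r) t = 𝟙 (t ≡ᵇ r ℕ.* s)

  0≡ᵇ-multiple : ∀ r → (0 ≡ᵇ r) ≡ (0 ≡ᵇ r ℕ.* s)
  0≡ᵇ-multiple zero = refl
  0≡ᵇ-multiple (suc r) = sym (≡ᵇ-false (ℕP.<⇒≢ (ℕP.≤-trans 1≤s (ℕP.m≤m+n s (r ℕ.* s)))))

  copies-total : ∀ r t → 𝟙 ((0 ≡ᵇ t) ∧ (0 ≡ᵇ r)) + (if s ≤ᵇ t then copiesAfterS r (t ∸ s) else 0ℤ) ≡ 𝟙 (t ≡ᵇ r ℕ.* s)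
  copies-total zero t = trans (cong₂ _+_ (cong 𝟙 (trans (BoolP.∧-identityʳ (0 ≡ᵇ t)) (≡ᵇ-sym 0 t))) (if-same (s ≤ᵇ t)))
                              (ℤP.+-identityʳ _)
    where
    if-same : ∀ c → (if c then 0ℤ else 0ℤ) ≡ 0ℤ
    if-same true = refl
    if-same false = refl
  copies-total (suc r) t = begin
    𝟙 ((0 ≡ᵇ t) ∧ false) + (if s ≤ᵇ t then 𝟙 (t ∸ s ≡ᵇ r ℕ.* s) else 0ℤ)
      ≡⟨ cong (λ c → 𝟙 c + (if s ≤ᵇ t then 𝟙 (t ∸ s ≡ᵇ r ℕ.* s) else 0ℤ)) (BoolP.∧-zeroʳ (0 ≡ᵇ t)) ⟩
    0ℤ + (if s ≤ᵇ t then 𝟙 (t ∸ s ≡ᵇ r ℕ.* s) else 0ℤ)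
      ≡⟨ ℤP.+-identityˡ _ ⟩
    (if s ≤ᵇ t then 𝟙 (t ∸ s ≡ᵇ r ℕ.* s) else 0ℤ)
      ≡⟨ 𝟙-∧ (s ≤ᵇ t) _ ⟨
    𝟙 ((s ≤ᵇ t) ∧ (t ∸ s ≡ᵇ r ℕ.* s))
      ≡⟨ cong 𝟙 (trans (cong ((s ≤ᵇ t) ∧_) (≡ᵇ-sym (t ∸ s) (r ℕ.* s)))
                       (trans (sym (+-≡ᵇ-split s (r ℕ.* s) t)) (≡ᵇ-sym (s ℕ.+ r ℕ.* s) t))) ⟩
    𝟙 (t ≡ᵇ s ℕ.+ r ℕ.* s) ∎
    where
    open ≡-Reasoning
    𝟙-∧ : ∀ c d → 𝟙 (c ∧ d) ≡ (if c then 𝟙 d else 0ℤ)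
    𝟙-∧ true d = refl
    𝟙-∧ false d = refl

  copies-startingWith : ∀ L r t b → startingWith L (copies r) t b false + startingWith L (copies r) t b true ≡ 𝟙 (s ≡ᵇ b) * startingWithS L r t
  copies-startingWith L r t b with b ℕP.≟ s
  ... | yes refl rewrite <ᵇ-false {b} {b} ℕP.≤-refl | ≡ᵇ-refl b =
    trans (ℤP.+-identityʳ _) (sym (ℤP.*-identityˡ _))
  ... | no b≢s = trans (cong₂ _+_ (vanish false) (vanish true))
                       (sym (cong (λ c → 𝟙 c * startingWithS L r t) (≡ᵇ-false {s} {b} (b≢s ∘ sym))))
    where
    vanish : ∀ y → startingWith L (copies r) t b y ≡ 0ℤ
    vanish y with follows s (b , y) ∧ (b ≤ᵇ t)
    ... | false = refl
    ... | true = enum-readS-other L r b y (t ∸ b) (cong (_∧ not y) (≡ᵇ-false b≢s))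

  ∸-≤-pred : ∀ {t L b} → t ≤ suc L → 1 ≤ b → t ∸ b ≤ L
  ∸-≤-pred {zero} {b = suc b} _ _ = z≤n
  ∸-≤-pred {suc t} {L} {suc b} (s≤s t≤L) _ = ℕP.≤-trans (ℕP.m∸n≤m t b) t≤L

  mutual
    copies-count : ∀ L r t → t ≤ L → enum L (weight (copies r) t) ≡ 𝟙 (t ≡ᵇ r ℕ.* s)
    copies-count zero r .zero z≤n = trans (enum-0 (weight (copies r) 0)) (cong 𝟙 (0≡ᵇ-multiple r))
    copies-count (suc L) r t t≤L = begin
      enum (suc L) (weight (copies r) t)
        ≡⟨ enum-weight-suc L (copies r) t ⟩
      I + ∑[ b < suc n ] (startingWith L (copies r) t b false + startingWith L (copies r) t b true)
        ≡⟨ cong (I +_) (trans (∑<-cong (suc n) (λ b _ → copies-startingWith L r t b)) (∑<-select (suc n) s (λ _ → startingWithS L r t))) ⟩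
      I + 𝟙 (s <ᵇ suc n) * startingWithS L r t
        ≡⟨ cong (I +_) (trans (cong (λ c → 𝟙 c * startingWithS L r t) (<ᵇ-true (s≤s s≤n))) (ℤP.*-identityˡ _)) ⟩
      I + startingWithS L r t
        ≡⟨ cong (I +_) (startingWithS≡copiesAfterS L r t t≤L) ⟩
      I + (if s ≤ᵇ t then copiesAfterS r (t ∸ s) else 0ℤ)
        ≡⟨ copies-total r t ⟩
      𝟙 (t ≡ᵇ r ℕ.* s) ∎
      where
      open ≡-Reasoning
      I = 𝟙 ((0 ≡ᵇ t) ∧ (0 ≡ᵇ r))

    startingWithS≡copiesAfterS : ∀ L r t → t ≤ suc L → startingWithS L r t ≡ (if s ≤ᵇ t then copiesAfterS r (t ∸ s) else 0ℤ)
    startingWithS≡copiesAfterS L r t t≤L with s ≤ᵇ t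
    ... | false = refl
    ... | true = afterS r
      where
      afterS : ∀ r → enum L (readS r s false (t ∸ s)) ≡ copiesAfterS r (t ∸ s)
      afterS zero = ∑-0 (lists L)
      afterS (suc r) rewrite ≡ᵇ-refl s = copies-count L r (t ∸ s) (∸-≤-pred t≤L 1≤s)

  firstPartCoeff-at-0 : ∀ b → firstPartCoeff b 0 ≡ 0ℤ
  firstPartCoeff-at-0 zero = refl
  firstPartCoeff-at-0 (suc b) = firstPartCoeff-vanish (s≤s z≤n)

  startingAbove : ℕ → ℕ → ℕ → ℤ
  startingAbove L t b = if b ≤ᵇ t then - enum L (weight (above b) (t ∸ b)) else 0ℤ

  startingWith-above-valid : ∀ L a t b y → validAbove s b ≡ true →
    startingWith L (above a) t b y ≡ 𝟙 (follows a (b , y)) * startingAbove L t b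
  startingWith-above-valid L a t b y v rewrite v with follows a (b , y)
  ... | false = refl
  ... | true with b ≤ᵇ t
  ...   | false = refl
  ...   | true = trans (∑-neg (lists L) (weight (above b) (t ∸ b))) (sym (ℤP.*-identityˡ _))

  startingWith-above-invalid : ∀ L a t b y → validAbove s b ≡ false →
    startingWith L (above a) t b y ≡ (if follows a (b , y) ∧ (b ≤ᵇ t) then enum L (readS k b y (t ∸ b)) else 0ℤ)
  startingWith-above-invalid L a t b y v rewrite v = refl

  firstPartSplit : ℕ → ℕ → ℕ → ℕ → ℤ
  firstPartSplit L a t b = 𝟙 (b <ᵇ a) * (firstPartCoeff b t + firstPartCoeff b t) + 𝟙 (a ≡ᵇ b) * firstPartCoeff b t
                           + 𝟙 (s ≡ᵇ b) * startingWithS L k t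

  above-startingWith-valid : ∀ L a t b → validAbove s b ≡ true → startingAbove L t b ≡ firstPartCoeff b t →
    startingWith L (above a) t b false + startingWith L (above a) t b true ≡ firstPartSplit L a t b
  above-startingWith-valid L a t b v startingAbove≡firstPartCoeff = begin
    startingWith L (above a) t b false + startingWith L (above a) t b true
      ≡⟨ cong₂ _+_ (startingWith-above-valid L a t b false v) (startingWith-above-valid L a t b true v) ⟩
    𝟙 (follows a (b , false)) * startingAbove L t b + 𝟙 (follows a (b , true)) * startingAbove L t b
      ≡⟨ ℤP.*-distribʳ-+ (startingAbove L t b) (𝟙 (follows a (b , false))) _ ⟨
    (𝟙 (follows a (b , false)) + 𝟙 (follows a (b , true))) * startingAbove L t b
      ≡⟨ cong₂ _*_ (follows-count a b) startingAbove≡firstPartCoeff ⟩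
    (𝟙 (b <ᵇ a) * ℤ.+ 2 + 𝟙 (a ≡ᵇ b)) * firstPartCoeff b t
      ≡⟨ regroup (𝟙 (b <ᵇ a)) (𝟙 (a ≡ᵇ b)) (firstPartCoeff b t) (startingWithS L k t) ⟩
    𝟙 (b <ᵇ a) * (firstPartCoeff b t + firstPartCoeff b t) + 𝟙 (a ≡ᵇ b) * firstPartCoeff b t + 0ℤ * startingWithS L k t
      ≡⟨ cong (λ c → 𝟙 (b <ᵇ a) * (firstPartCoeff b t + firstPartCoeff b t) + 𝟙 (a ≡ᵇ b) * firstPartCoeff b t + 𝟙 c * startingWithS L k t)
              (≡ᵇ-false (ℕP.<⇒≢ (validAbove⇒> {s} {b} v))) ⟨
    firstPartSplit L a t b ∎
    where
    open ≡-Reasoning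
    regroup : ∀ p q h e → (p * ℤ.+ 2 + q) * h ≡ p * (h + h) + q * h + 0ℤ * e
    regroup = solve-∀

  above-startingWith-s : ∀ L a t → s < a →
    startingWith L (above a) t s false + startingWith L (above a) t s true ≡ firstPartSplit L a t s
  above-startingWith-s L a t s<a = begin
    startingWith L (above a) t s false + startingWith L (above a) t s true
      ≡⟨ cong₂ _+_ (startingWith-above-invalid L a t s false s-invalid)
                   (trans (startingWith-above-invalid L a t s true s-invalid) (noOverlinedS (follows a (s , true) ∧ (s ≤ᵇ t)))) ⟩
    (if follows a (s , false) ∧ (s ≤ᵇ t) then enum L (readS k s false (t ∸ s)) else 0ℤ) + 0ℤ
      ≡⟨ ℤP.+-identityʳ _ ⟩
    (if follows a (s , false) ∧ (s ≤ᵇ t) then enum L (readS k s false (t ∸ s)) else 0ℤ)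
      ≡⟨ cong (λ c → if c ∧ (s ≤ᵇ t) then enum L (readS k s false (t ∸ s)) else 0ℤ) (cong (_∨ ((a ≡ᵇ s) ∧ true)) (<ᵇ-true s<a)) ⟩
    startingWithS L k t
      ≡⟨ clear (𝟙 (s <ᵇ a)) (𝟙 (a ≡ᵇ s)) (startingWithS L k t) ⟨
    𝟙 (s <ᵇ a) * (0ℤ + 0ℤ) + 𝟙 (a ≡ᵇ s) * 0ℤ + 1ℤ * startingWithS L k t
      ≡⟨ cong₂ (λ h c → 𝟙 (s <ᵇ a) * (h + h) + 𝟙 (a ≡ᵇ s) * h + 𝟙 c * startingWithS L k t)
               (firstPartCoeff-invalid {s} {t} s-invalid) (≡ᵇ-refl s) ⟨
    firstPartSplit L a t s ∎
    where
    open ≡-Reasoning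
    s-invalid : validAbove s s ≡ false
    s-invalid rewrite <ᵇ-false {s} {s} ℕP.≤-refl = refl
    noOverlinedS : ∀ c → (if c then enum L (readS k s true (t ∸ s)) else 0ℤ) ≡ 0ℤ
    noOverlinedS false = refl
    noOverlinedS true = enum-readS-other L k s true (t ∸ s) (BoolP.∧-zeroʳ (s ≡ᵇ s))
    clear : ∀ p q e → p * (0ℤ + 0ℤ) + q * 0ℤ + 1ℤ * e ≡ e
    clear = solve-∀

  above-startingWith-other : ∀ L a t b → validAbove s b ≡ false → b ≢ s →
    startingWith L (above a) t b false + startingWith L (above a) t b true ≡ firstPartSplit L a t b
  above-startingWith-other L a t b v b≢s = begin
    startingWith L (above a) t b false + startingWith L (above a) t b true
      ≡⟨ cong₂ _+_ (trans (startingWith-above-invalid L a t b false v) (vanish false))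
                   (trans (startingWith-above-invalid L a t b true v) (vanish true)) ⟩
    0ℤ
      ≡⟨ clear (𝟙 (b <ᵇ a)) (𝟙 (a ≡ᵇ b)) (startingWithS L k t) ⟨
    𝟙 (b <ᵇ a) * (0ℤ + 0ℤ) + 𝟙 (a ≡ᵇ b) * 0ℤ + 0ℤ * startingWithS L k t
      ≡⟨ cong₂ (λ h c → 𝟙 (b <ᵇ a) * (h + h) + 𝟙 (a ≡ᵇ b) * h + 𝟙 c * startingWithS L k t)
               (firstPartCoeff-invalid {b} {t} v) (≡ᵇ-false (b≢s ∘ sym)) ⟨
    firstPartSplit L a t b ∎
    where
    open ≡-Reasoning
    vanish : ∀ y → (if follows a (b , y) ∧ (b ≤ᵇ t) then enum L (readS k b y (t ∸ b)) else 0ℤ) ≡ 0ℤ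
    vanish y with follows a (b , y) ∧ (b ≤ᵇ t)
    ... | false = refl
    ... | true = enum-readS-other L k b y (t ∸ b) (cong (_∧ not y) (≡ᵇ-false b≢s))
    clear : ∀ p q e → p * (0ℤ + 0ℤ) + q * 0ℤ + 0ℤ * e ≡ 0ℤ
    clear = solve-∀

  above-startingWith : ∀ L a t b → s < a → (validAbove s b ≡ true → startingAbove L t b ≡ firstPartCoeff b t) →
    startingWith L (above a) t b false + startingWith L (above a) t b true ≡ firstPartSplit L a t b
  above-startingWith L a t b s<a startingAbove≡firstPartCoeff = byValidity (validAbove s b) refl (b ℕP.≟ s)
    where
    byValidity : ∀ v → validAbove s b ≡ v → Dec (b ≡ s) →
      startingWith L (above a) t b false + startingWith L (above a) t b true ≡ firstPartSplit L a t b
    byValidity true v _ = above-startingWith-valid L a t b v (startingAbove≡firstPartCoeff v)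
    byValidity false v (yes b≡s) =
      subst (λ b → startingWith L (above a) t b false + startingWith L (above a) t b true ≡ firstPartSplit L a t b)
            (sym b≡s) (above-startingWith-s L a t s<a)
    byValidity false v (no b≢s) = above-startingWith-other L a t b v b≢s

  tailsAfter-at-0 : ∀ a → tailsAfter a 0 ≡ 𝟙 (0 ≡ᵇ k ℕ.* s)
  tailsAfter-at-0 a = begin
    tailsAfter a 0
      ≡⟨ tailsAfter-coeff a 0 ⟩
    tailsBelow a 0 + firstPartCoeff a 0
      ≡⟨ cong₂ _+_ (tailsBelow-coeff a 0) (firstPartCoeff-at-0 a) ⟩
    𝟙 (0 ≡ᵇ k ℕ.* s) + ∑[ b < a ] (firstPartCoeff b 0 + firstPartCoeff b 0) + 0ℤ
      ≡⟨ cong (λ x → 𝟙 (0 ≡ᵇ k ℕ.* s) + x + 0ℤ)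
              (trans (∑<-cong a (λ b _ → cong₂ _+_ (firstPartCoeff-at-0 b) (firstPartCoeff-at-0 b))) (∑<-0 a)) ⟩
    𝟙 (0 ≡ᵇ k ℕ.* s) + 0ℤ + 0ℤ
      ≡⟨ trans (ℤP.+-identityʳ _) (ℤP.+-identityʳ _) ⟩
    𝟙 (0 ≡ᵇ k ℕ.* s) ∎
    where open ≡-Reasoning

  ∑-firstPartSplit : ∀ L a t → t ≤ n →
    ∑[ b < suc n ] firstPartSplit L a t b ≡ ∑[ b < a ] (firstPartCoeff b t + firstPartCoeff b t) + firstPartCoeff a t + startingWithS L k t
  ∑-firstPartSplit L a t t≤n = begin
    ∑[ b < suc n ] (f₁ b + f₂ b + f₃ b)
      ≡⟨ trans (∑<-distrib-+ (suc n) (λ b → f₁ b + f₂ b) f₃) (cong (_+ ∑< (suc n) f₃) (∑<-distrib-+ (suc n) f₁ f₂)) ⟩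
    ∑< (suc n) f₁ + ∑< (suc n) f₂ + ∑< (suc n) f₃
      ≡⟨ cong₂ _+_ (cong₂ _+_ (∑<-𝟙<ᵇ (suc n) a (λ b → h b + h b) twoBeyond) (∑<-select (suc n) a h))
                   (∑<-select (suc n) s (λ _ → S)) ⟩
    ∑[ b < a ] (h b + h b) + 𝟙 (a <ᵇ suc n) * h a + 𝟙 (s <ᵇ suc n) * S
      ≡⟨ cong₂ _+_ (cong (∑[ b < a ] (h b + h b) +_) lastCoeff)
                   (trans (cong (λ c → 𝟙 c * S) (<ᵇ-true (s≤s s≤n))) (ℤP.*-identityˡ S)) ⟩
    ∑[ b < a ] (h b + h b) + h a + S ∎
    where
    open ≡-Reasoning
    S = startingWithS L k t
    h f₁ f₂ f₃ : ℕ → ℤ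
    h b = firstPartCoeff b t
    f₁ b = 𝟙 (b <ᵇ a) * (h b + h b)
    f₂ b = 𝟙 (a ≡ᵇ b) * h b
    f₃ b = 𝟙 (s ≡ᵇ b) * S
    twoBeyond : ∀ b → suc n ≤ b → h b + h b ≡ 0ℤ
    twoBeyond b n<b rewrite firstPartCoeff-vanish {b} {t} (ℕP.≤-<-trans t≤n n<b) = refl
    lastCoeff : 𝟙 (a <ᵇ suc n) * h a ≡ h a
    lastCoeff with a <ᵇ suc n | ℕP.<ᵇ-reflects-< a (suc n)
    ... | true | _ = ℤP.*-identityˡ (h a)
    ... | false | ofⁿ a≮n = sym (firstPartCoeff-vanish (ℕP.≤-<-trans t≤n (ℕP.≰⇒> (a≮n ∘ s≤s))))

  above-count : ∀ L a t → s < a → t ≤ L → t ≤ n → enum L (weight (above a) t) ≡ tailsAfter a t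
  above-count zero a .zero s<a z≤n _ =
    trans (enum-0 (weight (above a) 0)) (trans (cong 𝟙 (0≡ᵇ-multiple k)) (sym (tailsAfter-at-0 a)))
  above-count (suc L) a t s<a t≤L t≤n = begin
    enum (suc L) (weight (above a) t)
      ≡⟨ enum-weight-suc L (above a) t ⟩
    I + ∑[ b < suc n ] (startingWith L (above a) t b false + startingWith L (above a) t b true)
      ≡⟨ cong (I +_) (trans (∑<-cong (suc n) (λ b _ → above-startingWith L a t b s<a (startingAbove≡firstPartCoeff b)))
                            (∑-firstPartSplit L a t t≤n)) ⟩
    I + (∑[ b < a ] (h b + h b) + h a + S)
      ≡⟨ regroup I (∑[ b < a ] (h b + h b)) (h a) S ⟩
    (I + S) + ∑[ b < a ] (h b + h b) + h a
      ≡⟨ cong (λ x → x + ∑[ b < a ] (h b + h b) + h a) (trans (cong (I +_) (startingWithS≡copiesAfterS L k t t≤L)) (copies-total k t)) ⟩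
    𝟙 (t ≡ᵇ k ℕ.* s) + ∑[ b < a ] (h b + h b) + h a
      ≡⟨ cong (_+ h a) (tailsBelow-coeff a t) ⟨
    tailsBelow a t + h a
      ≡⟨ tailsAfter-coeff a t ⟨
    tailsAfter a t ∎
    where
    open ≡-Reasoning
    I = 𝟙 ((0 ≡ᵇ t) ∧ (0 ≡ᵇ k))
    S = startingWithS L k t
    h : ℕ → ℤ
    h b = firstPartCoeff b t
    regroup : ∀ i x y z → i + (x + y + z) ≡ i + z + x + y
    regroup = solve-∀
    startingAbove≡firstPartCoeff : ∀ b → validAbove s b ≡ true → startingAbove L t b ≡ firstPartCoeff b t
    startingAbove≡firstPartCoeff b v with b ≤ᵇ t | ℕP.≤ᵇ-reflects-≤ b t
    ... | false | ofⁿ b≰t =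
      sym (trans (firstPartCoeff-valid {b} {t} v) (cong -_ (mono-⊛-coeff-< 1ℤ b (tailsAtMost b) t (ℕP.≰⇒> b≰t))))
    ... | true | ofʸ b≤t = begin
      - enum L (weight (above b) (t ∸ b))  ≡⟨ cong -_ (above-count L b (t ∸ b) s<b (∸-≤-pred t≤L (ℕP.≤-<-trans z≤n s<b))
                                                                      (ℕP.≤-trans (ℕP.m∸n≤m t b) t≤n)) ⟩
      - tailsAfter b (t ∸ b)               ≡⟨ cong (λ f → - f (t ∸ b)) (tailsAfter-valid {b} v) ⟩
      - tailsAtMost b (t ∸ b)              ≡⟨ cong -_ (trans (mono-⊛-coeff-≥ 1ℤ b (tailsAtMost b) t b≤t) (ℤP.*-identityˡ _)) ⟨
      - (X^ b ⊛ tailsAtMost b) t           ≡⟨ firstPartCoeff-valid {b} {t} v ⟨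
      firstPartCoeff b t                   ∎
      where
      s<b : s < b
      s<b = validAbove⇒> v

sptTerm-split : ∀ k → 1 ≤ k → ∀ n π →
  sptTerm k n π ≡ ∑[ j < n ] SmallestPart.weight (suc j) k (SmallestPart.above (suc n)) n π
sptTerm-split k 1≤k n π =
  trans (sptTerm-by-smallest k n π) (∑<-cong n (λ j _ → sym (SmallestPart.weight≡sptTerm (suc j) k (s≤s z≤n) 1≤k n π)))

spt′ko-formula : ∀ k → 1 ≤ k → ∀ n → spt′ko k n ≡ ∑[ j < n ] (X^ (k ℕ.* suc j) ⊛ pochRatio (suc j) (suc n)) n
spt′ko-formula k 1≤k n = begin
  ∑ (candidates n) (sptTerm k n)
    ≡⟨ ∑-cong (candidates n) (sptTerm-split k 1≤k n) ⟩
  enum n n (λ π → ∑[ j < n ] SmallestPart.weight (suc j) k (SmallestPart.above (suc n)) n π)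
    ≡⟨ enum-∑< n n n (λ j → SmallestPart.weight (suc j) k (SmallestPart.above (suc n)) n) ⟩
  ∑[ j < n ] enum n n (SmallestPart.weight (suc j) k (SmallestPart.above (suc n)) n)
    ≡⟨ ∑<-cong n (λ j j<n → byCounting j j<n) ⟩
  ∑[ j < n ] (X^ (k ℕ.* suc j) ⊛ pochRatio (suc j) (suc n)) n ∎
  where
  open ≡-Reasoning
  open Enumeration using (enum; enum-∑<)
  byCounting : ∀ j → j < n → enum n n (SmallestPart.weight (suc j) k (SmallestPart.above (suc n)) n)
                            ≡ (X^ (k ℕ.* suc j) ⊛ pochRatio (suc j) (suc n)) n
  byCounting j j<n = begin
    enum n n (weight (above (suc n)) n)              ≡⟨ above-count n (suc n) n (s≤s j<n) ℕP.≤-refl ℕP.≤-refl ⟩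
    tailsAfter (suc n) n                             ≡⟨ tailsAfter-coeff (suc n) n ⟩
    tailsBelow (suc n) n + firstPartCoeff (suc n) n  ≡⟨ cong (tailsBelow (suc n) n +_) (firstPartCoeff-vanish (ℕP.n<1+n n)) ⟩
    tailsBelow (suc n) n + 0ℤ                        ≡⟨ ℤP.+-identityʳ _ ⟩
    tailsBelow (suc n) n                             ∎
    where
    open SmallestPart (suc j) k using (weight; above)
    open GeneratingSeries (suc j) k
    open Counting n (suc j) k (s≤s z≤n) j<n using (above-count)

sptGF-coeff : ∀ k → 1 ≤ k → ∀ n → sptGF k n ≡ ∑[ j < n ] (X^ (k ℕ.* suc j) ⊛ pochRatio (suc j) (suc n)) n
sptGF-coeff k 1≤k zero = refl
sptGF-coeff k 1≤k (suc n) = spt′ko-formula k 1≤k (suc n)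

weightedSum : ℕ → ℕ → (ℕ → Series) → Series
weightedSum e zero a = 0S
weightedSum e (suc N) a = weightedSum e N a ⊕ X^ (e ℕ.* suc N) ⊛ a (suc N)

weightedSum-coeff : ∀ e N a i → weightedSum e N a i ≡ ∑[ j < N ] (X^ (e ℕ.* suc j) ⊛ a (suc j)) i
weightedSum-coeff e zero a i = 0S-coeff i
weightedSum-coeff e (suc N) a i =
  trans (cong (_+ (X^ (e ℕ.* suc N) ⊛ a (suc N)) i) (weightedSum-coeff e N a i)) (sym (∑<-suc N _))

sptGF-≈[] : ∀ k → 1 ≤ k → ∀ M N {t} → t < M → t ≤ N → sptGF k ≈[ t ] weightedSum k N (λ s → pochRatio s M)
sptGF-≈[] k 1≤k M N {t} t<M t≤N = mk≈ λ i i≤t → begin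
  sptGF k i
    ≡⟨ sptGF-coeff k 1≤k i ⟩
  ∑[ j < i ] (X^ (k ℕ.* suc j) ⊛ pochRatio (suc j) (suc i)) i
    ≡⟨ ∑<-cong i (λ j _ → coeff≤ (⊛-≈[]ˡ (X^ (k ℕ.* suc j)) (stable j i≤t)) i ℕP.≤-refl) ⟩
  ∑[ j < i ] (X^ (k ℕ.* suc j) ⊛ pochRatio (suc j) M) i
    ≡⟨ ∑<-extend i (N ∸ i) _ (λ j i≤j → mono-⊛-coeff-< 1ℤ (k ℕ.* suc j) (pochRatio (suc j) M) i (ℕP.<-≤-trans (s≤s i≤j) (k*-≥ j))) ⟨
  ∑[ j < i ℕ.+ (N ∸ i) ] (X^ (k ℕ.* suc j) ⊛ pochRatio (suc j) M) i
    ≡⟨ cong (λ m → ∑[ j < m ] (X^ (k ℕ.* suc j) ⊛ pochRatio (suc j) M) i) (ℕP.m+[n∸m]≡n (ℕP.≤-trans i≤t t≤N)) ⟩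
  ∑[ j < N ] (X^ (k ℕ.* suc j) ⊛ pochRatio (suc j) M) i
    ≡⟨ weightedSum-coeff k N (λ s → pochRatio s M) i ⟨
  weightedSum k N (λ s → pochRatio s M) i ∎
  where
  open ≡-Reasoning
  k*-≥ : ∀ j → suc j ≤ k ℕ.* suc j
  k*-≥ j = ℕP.m≤n*m (suc j) k ⦃ ℕ.>-nonZero 1≤k ⦄
  stable : ∀ j {i} → i ≤ t → pochRatio (suc j) (suc i) ≈[ i ] pochRatio (suc j) M
  stable j {i} i≤t = ≈[]-sym (subst (λ m → pochRatio (suc j) m ≈[ i ] pochRatio (suc j) (suc i))
                                    (ℕP.m+[n∸m]≡n (ℕP.≤-trans (s≤s i≤t) t<M))
                                    (pochRatio-stable (suc j) (suc i) (M ∸ suc i) ℕP.≤-refl))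

-- The recursion in k

module Telescoping (j : ℕ) (a : ℕ → Series) where

  q u : Series
  q = X^ 1
  u = X^ j

  Relation : ℕ → Set
  Relation s = (oneS ⊕ X^ (suc s)) ⊛ a s ≋ (oneS ⊕ ⊖ X^ (suc s)) ⊛ a (suc (suc s))

  edge : ℕ → Series
  edge m = (q ⊛ X^ (j ℕ.* m) ⊕ ⊖ X^ (suc j ℕ.* m)) ⊛ a m

  mainTerms : Series → Series
  mainTerms F = (q ⊕ ⊖ (q ⊛ u ⊛ u)) ⊛ F ⊕ ⊖ (q ⊛ u ⊛ u ⊛ ((oneS ⊕ ⊖ q) ⊛ a 2))

  telescoped : ℕ → Series
  telescoped N = mainTerms (weightedSum j N a) ⊕ (edge (suc N) ⊕ edge (suc (suc N)))

  X^-j* : ∀ m → X^ (j ℕ.* suc m) ≋ u ⊛ X^ (j ℕ.* m)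
  X^-j* m = ≋-trans (≋-reflexive (cong X^_ (ℕP.*-suc j m))) (X^-+ j (j ℕ.* m))

  edge-≋ : ∀ m → edge m ≋ (q ⊕ ⊖ X^ m) ⊛ (X^ (j ℕ.* m) ⊛ a m)
  edge-≋ m = ≋-trans (⊛-congʳ (a m) (⊕-congˡ (q ⊛ X^ (j ℕ.* m)) (⊖-cong (X^-+ m (j ℕ.* m)))))
                     (factorOut q (X^ m) (X^ (j ℕ.* m)) (a m))
    where
    open SeriesSolver
    factorOut : ∀ q v p x → (q ⊛ p ⊕ ⊖ (v ⊛ p)) ⊛ x ≋ (q ⊕ ⊖ v) ⊛ (p ⊛ x)
    factorOut = solve 4 (λ q v p x → (q :* p :- v :* p) :* x := (q :- v) :* (p :* x)) ≋-refl

  edge-suc : ∀ m → edge (suc m) ≋ (q ⊕ ⊖ (q ⊛ X^ m)) ⊛ ((u ⊛ X^ (j ℕ.* m)) ⊛ a (suc m))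
  edge-suc m = ≋-trans (edge-≋ (suc m)) (⊛-cong (⊕-congˡ q (⊖-cong (X^-suc m))) (⊛-congʳ (a (suc m)) (X^-j* m)))

  telescoped-0 : (oneS ⊕ q ⊛ q ⊛ u ⊛ u) ⊛ 0S ≋ telescoped 0
  telescoped-0 = begin
    (oneS ⊕ q ⊛ q ⊛ u ⊛ u) ⊛ 0S
      ≈⟨ base q u (a 1) (a 2) ⟩
    mainTerms 0S ⊕ ((q ⊕ ⊖ (q ⊛ oneS)) ⊛ ((u ⊛ oneS) ⊛ a 1) ⊕ (q ⊕ ⊖ (q ⊛ q)) ⊛ ((u ⊛ (u ⊛ oneS)) ⊛ a 2))
      ≈⟨ ⊕-congˡ (mainTerms 0S) (⊕-cong (≋-sym firstEdge) (≋-sym secondEdge)) ⟩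
    telescoped 0 ∎
    where
    open ≋-Reasoning
    open SeriesSolver
    X^j0 : X^ (j ℕ.* 0) ≋ oneS
    X^j0 = ≋-trans (≋-reflexive (cong X^_ (ℕP.*-zeroʳ j))) X^0≋1
    firstEdge : edge 1 ≋ (q ⊕ ⊖ (q ⊛ oneS)) ⊛ ((u ⊛ oneS) ⊛ a 1)
    firstEdge = ≋-trans (edge-suc 0) (⊛-cong (⊕-congˡ q (⊖-cong (⊛-congˡ q X^0≋1))) (⊛-congʳ (a 1) (⊛-congˡ u X^j0)))
    secondEdge : edge 2 ≋ (q ⊕ ⊖ (q ⊛ q)) ⊛ ((u ⊛ (u ⊛ oneS)) ⊛ a 2)
    secondEdge = ≋-trans (edge-suc 1) (⊛-congˡ (q ⊕ ⊖ (q ⊛ q)) (⊛-congʳ (a 2) (⊛-congˡ u (≋-trans (X^-j* 0) (⊛-congˡ u X^j0)))))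
    base : ∀ q u a₁ a₂ → (oneS ⊕ q ⊛ q ⊛ u ⊛ u) ⊛ 0S ≋
      (q ⊕ ⊖ (q ⊛ u ⊛ u)) ⊛ 0S ⊕ ⊖ (q ⊛ u ⊛ u ⊛ ((oneS ⊕ ⊖ q) ⊛ a₂))
        ⊕ ((q ⊕ ⊖ (q ⊛ oneS)) ⊛ ((u ⊛ oneS) ⊛ a₁) ⊕ (q ⊕ ⊖ (q ⊛ q)) ⊛ ((u ⊛ (u ⊛ oneS)) ⊛ a₂))
    base = solve 4 (λ q u a₁ a₂ → (con 1ℤ :+ q :* q :* u :* u) :* con 0ℤ :=
      (q :- q :* u :* u) :* con 0ℤ :- q :* u :* u :* ((con 1ℤ :- q) :* a₂)
        :+ ((q :- q :* con 1ℤ) :* ((u :* con 1ℤ) :* a₁) :+ (q :- q :* q) :* ((u :* (u :* con 1ℤ)) :* a₂))) ≋-refl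

  -- Adding the term s = m to both sides uses the relation at s = m, multiplied by q^{1+j(m+2)}.
  telescoped-suc : ∀ N → Relation (suc N) →
    telescoped N ⊕ (oneS ⊕ q ⊛ q ⊛ u ⊛ u) ⊛ (X^ (suc j ℕ.* suc N) ⊛ a (suc N)) ≋ telescoped (suc N)
  telescoped-suc N relₘ = begin
    mainTerms F ⊕ (edge m ⊕ edge (suc m)) ⊕ (oneS ⊕ q ⊛ q ⊛ u ⊛ u) ⊛ (X^ (suc j ℕ.* m) ⊛ a m)
      ≈⟨ ⊕-cong (⊕-congˡ (mainTerms F) (⊕-congʳ (edge (suc m)) (edge-≋ m)))
                (⊛-congˡ (oneS ⊕ q ⊛ q ⊛ u ⊛ u) (⊛-congʳ (a m) (X^-+ m (j ℕ.* m)))) ⟩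
    mainTerms F ⊕ ((q ⊕ ⊖ v) ⊛ (P ⊛ a m) ⊕ edge (suc m)) ⊕ (oneS ⊕ q ⊛ q ⊛ u ⊛ u) ⊛ (v ⊛ P ⊛ a m)
      ≈⟨ step q u v P F (a m) (a 2) (edge (suc m)) (a (suc (suc m))) ⟩
    mainTerms (F ⊕ P ⊛ a m) ⊕ (edge (suc m) ⊕ (q ⊕ ⊖ (q ⊛ (q ⊛ v))) ⊛ ((u ⊛ (u ⊛ P)) ⊛ a (suc (suc m))))
      ⊕ q ⊛ u ⊛ u ⊛ P ⊛ ((oneS ⊕ q ⊛ v) ⊛ a m ⊕ ⊖ ((oneS ⊕ ⊖ (q ⊛ v)) ⊛ a (suc (suc m))))
      ≈⟨ ⊕-cong (⊕-congˡ (mainTerms (F ⊕ P ⊛ a m)) (⊕-congˡ (edge (suc m)) (≋-sym lastEdge))) (⊛-congˡ (q ⊛ u ⊛ u ⊛ P) relation≋0) ⟩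
    telescoped (suc N) ⊕ q ⊛ u ⊛ u ⊛ P ⊛ 0S
      ≈⟨ dropZero (telescoped (suc N)) (q ⊛ u ⊛ u ⊛ P) ⟩
    telescoped (suc N) ∎
    where
    open ≋-Reasoning
    open SeriesSolver
    m = suc N
    v = X^ m
    P = X^ (j ℕ.* m)
    F = weightedSum j N a
    lastEdge : edge (suc (suc m)) ≋ (q ⊕ ⊖ (q ⊛ (q ⊛ v))) ⊛ ((u ⊛ (u ⊛ P)) ⊛ a (suc (suc m)))
    lastEdge = ≋-trans (edge-suc (suc m)) (⊛-cong (⊕-congˡ q (⊖-cong (⊛-congˡ q (X^-suc m))))
                                                  (⊛-congʳ (a (suc (suc m))) (⊛-congˡ u (X^-j* m))))
    cancel : ∀ x → x ⊕ ⊖ x ≋ 0S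
    cancel = solve 1 (λ x → x :- x := con 0ℤ) ≋-refl
    relation≋0 : (oneS ⊕ q ⊛ v) ⊛ a m ⊕ ⊖ ((oneS ⊕ ⊖ (q ⊛ v)) ⊛ a (suc (suc m))) ≋ 0S
    relation≋0 = ≋-trans (⊕-congʳ (⊖ ((oneS ⊕ ⊖ (q ⊛ v)) ⊛ a (suc (suc m))))
                                  (≋-trans (⊛-congʳ (a m) (⊕-congˡ oneS (≋-sym (X^-suc m))))
                                           (≋-trans relₘ (⊛-congʳ (a (suc (suc m))) (⊕-congˡ oneS (⊖-cong (X^-suc m)))))))
                         (cancel ((oneS ⊕ ⊖ (q ⊛ v)) ⊛ a (suc (suc m))))
    dropZero : ∀ x y → x ⊕ y ⊛ 0S ≋ x
    dropZero = solve 2 (λ x y → x :+ y :* con 0ℤ := x) ≋-refl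
    step : ∀ q u v P F a₁ a₂ e a₃ →
      (q ⊕ ⊖ (q ⊛ u ⊛ u)) ⊛ F ⊕ ⊖ (q ⊛ u ⊛ u ⊛ ((oneS ⊕ ⊖ q) ⊛ a₂)) ⊕ ((q ⊕ ⊖ v) ⊛ (P ⊛ a₁) ⊕ e)
        ⊕ (oneS ⊕ q ⊛ q ⊛ u ⊛ u) ⊛ (v ⊛ P ⊛ a₁)
      ≋ (q ⊕ ⊖ (q ⊛ u ⊛ u)) ⊛ (F ⊕ P ⊛ a₁) ⊕ ⊖ (q ⊛ u ⊛ u ⊛ ((oneS ⊕ ⊖ q) ⊛ a₂))
          ⊕ (e ⊕ (q ⊕ ⊖ (q ⊛ (q ⊛ v))) ⊛ ((u ⊛ (u ⊛ P)) ⊛ a₃))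
        ⊕ q ⊛ u ⊛ u ⊛ P ⊛ ((oneS ⊕ q ⊛ v) ⊛ a₁ ⊕ ⊖ ((oneS ⊕ ⊖ (q ⊛ v)) ⊛ a₃))
    step = solve 9 (λ q u v P F a₁ a₂ e a₃ →
      (q :- q :* u :* u) :* F :- q :* u :* u :* ((con 1ℤ :- q) :* a₂) :+ ((q :- v) :* (P :* a₁) :+ e)
        :+ (con 1ℤ :+ q :* q :* u :* u) :* (v :* P :* a₁)
      := (q :- q :* u :* u) :* (F :+ P :* a₁) :- q :* u :* u :* ((con 1ℤ :- q) :* a₂)
          :+ (e :+ (q :- q :* (q :* v)) :* ((u :* (u :* P)) :* a₃))
        :+ q :* u :* u :* P :* ((con 1ℤ :+ q :* v) :* a₁ :- (con 1ℤ :- q :* v) :* a₃)) ≋-refl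

  telescoping : ∀ N → (∀ s → 1 ≤ s → s ≤ N → Relation s) →
    (oneS ⊕ q ⊛ q ⊛ u ⊛ u) ⊛ weightedSum (suc j) N a ≋ telescoped N
  telescoping zero _ = telescoped-0
  telescoping (suc N) rel = begin
    c ⊛ (weightedSum (suc j) N a ⊕ X^ (suc j ℕ.* suc N) ⊛ a (suc N))
      ≈⟨ ⊛-distribˡ c (weightedSum (suc j) N a) _ ⟩
    c ⊛ weightedSum (suc j) N a ⊕ c ⊛ (X^ (suc j ℕ.* suc N) ⊛ a (suc N))
      ≈⟨ ⊕-congʳ (c ⊛ (X^ (suc j ℕ.* suc N) ⊛ a (suc N))) (telescoping N (λ s 1≤s s≤N → rel s 1≤s (ℕP.m≤n⇒m≤1+n s≤N))) ⟩
    telescoped N ⊕ c ⊛ (X^ (suc j ℕ.* suc N) ⊛ a (suc N))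
      ≈⟨ telescoped-suc N (rel (suc N) (s≤s z≤n) ℕP.≤-refl) ⟩
    telescoped (suc N) ∎
    where
    open ≋-Reasoning
    c = oneS ⊕ q ⊛ q ⊛ u ⊛ u

module SptRecurrence (j t : ℕ) where

  M : ℕ
  M = 2 ℕ.* suc (suc (suc t))

  a : ℕ → Series
  a s = pochRatio s M

  open Telescoping j a public

  t+3≤M : suc (suc (suc t)) ≤ M
  t+3≤M = ℕP.m≤m+n (suc (suc (suc t))) _

  t<M : t < M
  t<M = ℕP.≤-trans (ℕP.n≤1+n _) (ℕP.≤-trans (ℕP.n≤1+n _) t+3≤M)

  relations : ∀ s → 1 ≤ s → s ≤ t → Relation s
  relations s _ s≤t = pochRatio-recurrence s M (ℕP.≤-trans (s≤s (s≤s s≤t)) (ℕP.≤-trans (ℕP.n≤1+n _) t+3≤M))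

  sptGF-telescoped : (oneS ⊕ q ⊛ q ⊛ u ⊛ u) ⊛ sptGF (suc j) ≈[ t ]
    (q ⊕ ⊖ (q ⊛ u ⊛ u)) ⊛ weightedSum j t a ⊕ ⊖ (q ⊛ u ⊛ u ⊛ ((oneS ⊕ q) ⊛ oddRatio)) ⊕ (edge (suc t) ⊕ edge (suc (suc t)))
  sptGF-telescoped = begin
    (oneS ⊕ q ⊛ q ⊛ u ⊛ u) ⊛ sptGF (suc j)
      ≈⟨ ⊛-≈[]ˡ (oneS ⊕ q ⊛ q ⊛ u ⊛ u) (sptGF-≈[] (suc j) (s≤s z≤n) M t t<M ℕP.≤-refl) ⟩
    (oneS ⊕ q ⊛ q ⊛ u ⊛ u) ⊛ weightedSum (suc j) t a
      ≈⟨ ≋⇒≈[] (telescoping t relations) ⟩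
    (q ⊕ ⊖ (q ⊛ u ⊛ u)) ⊛ weightedSum j t a ⊕ ⊖ (q ⊛ u ⊛ u ⊛ ((oneS ⊕ ⊖ q) ⊛ a 2)) ⊕ (edge (suc t) ⊕ edge (suc (suc t)))
      ≈⟨ ⊕-≈[]ʳ (edge (suc t) ⊕ edge (suc (suc t)))
                (⊕-≈[]ˡ ((q ⊕ ⊖ (q ⊛ u ⊛ u)) ⊛ weightedSum j t a) (⊖-≈[] (⊛-≈[]ˡ (q ⊛ u ⊛ u) oddFactor))) ⟩
    (q ⊕ ⊖ (q ⊛ u ⊛ u)) ⊛ weightedSum j t a ⊕ ⊖ (q ⊛ u ⊛ u ⊛ ((oneS ⊕ q) ⊛ oddRatio)) ⊕ (edge (suc t) ⊕ edge (suc (suc t))) ∎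
    where
    open ≈[]-Reasoning t
    oddFactor : (oneS ⊕ ⊖ q) ⊛ a 2 ≈[ t ] (oneS ⊕ q) ⊛ oddRatio
    oddFactor = begin
      (oneS ⊕ ⊖ q) ⊛ pochRatio 2 M   ≈⟨ ≋⇒≈[] (≋-sym (pochRatio-recurrence 0 M (ℕP.≤-trans (s≤s (s≤s z≤n)) t+3≤M))) ⟩
      (oneS ⊕ q) ⊛ pochRatio 0 M     ≈⟨ ⊛-≈[]ˡ (oneS ⊕ q) (≈[]-sym (oddRatio-≈[] (suc (suc (suc t))) (ℕP.m≤n⇒m≤1+n t<M))) ⟩
      (oneS ⊕ q) ⊛ oddRatio          ∎

  edge-≈[] : ∀ m → t < m → edge m ≈[ t ] q ⊛ X^ (j ℕ.* m)
  edge-≈[] m t<m = begin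
    edge m
      ≈⟨ ≋⇒≈[] (≋-trans (edge-≋ m) (distribʳ q (X^ m) (X^ (j ℕ.* m) ⊛ a m))) ⟩
    q ⊛ (X^ (j ℕ.* m) ⊛ a m) ⊕ ⊖ (X^ m ⊛ (X^ (j ℕ.* m) ⊛ a m))
      ≈⟨ ⊕-≈[]ˡ (q ⊛ (X^ (j ℕ.* m) ⊛ a m)) (⊖-≈[] (X^-⊛-≈[]-0 m _ t<m)) ⟩
    q ⊛ (X^ (j ℕ.* m) ⊛ a m) ⊕ ⊖ 0S
      ≈⟨ ⊕-≈[]ʳ (⊖ 0S) (⊛-≈[]ˡ q (⊛-≈[]ˡ (X^ (j ℕ.* m)) (pochRatio-low m M (ℕP.<⇒≤ t<m)))) ⟩
    q ⊛ (X^ (j ℕ.* m) ⊛ oneS) ⊕ ⊖ 0S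
      ≈⟨ ≋⇒≈[] (unit q (X^ (j ℕ.* m))) ⟩
    q ⊛ X^ (j ℕ.* m) ∎
    where
    open ≈[]-Reasoning t
    open SeriesSolver
    distribʳ : ∀ q v x → (q ⊕ ⊖ v) ⊛ x ≋ q ⊛ x ⊕ ⊖ (v ⊛ x)
    distribʳ = solve 3 (λ q v x → (q :- v) :* x := q :* x :- v :* x) ≋-refl
    unit : ∀ q p → q ⊛ (p ⊛ oneS) ⊕ ⊖ 0S ≋ q ⊛ p
    unit = solve 2 (λ q p → q :* (p :* con 1ℤ) :- con 0ℤ := q :* p) ≋-refl

  edge-≈[]-0 : 1 ≤ j → ∀ m → t < m → edge m ≈[ t ] 0S
  edge-≈[]-0 1≤j m t<m = begin
    edge m             ≈⟨ edge-≈[] m t<m ⟩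
    q ⊛ X^ (j ℕ.* m)   ≈⟨ ≋⇒≈[] (⊛-comm q (X^ (j ℕ.* m))) ⟩
    X^ (j ℕ.* m) ⊛ q   ≈⟨ X^-⊛-≈[]-0 (j ℕ.* m) q (ℕP.<-≤-trans t<m (ℕP.m≤n*m m j ⦃ ℕ.>-nonZero 1≤j ⦄)) ⟩
    0S                 ∎
    where open ≈[]-Reasoning t

  edge-≈[]-q : j ≡ 0 → ∀ m → t < m → edge m ≈[ t ] q
  edge-≈[]-q refl m t<m = begin
    edge m             ≈⟨ edge-≈[] m t<m ⟩
    q ⊛ X^ 0           ≈⟨ ≋⇒≈[] (≋-trans (⊛-congˡ q X^0≋1) (⊛-identityʳ q)) ⟩
    q                  ∎
    where open ≈[]-Reasoning t

recurrenceStep : ℕ → Series → Series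
recurrenceStep k g = (X^ 1 ⊕ mono (- 1ℤ) (2 ℕ.* k ℕ.+ 3)) ⊛ g ⊕ ⊖ (X^ (2 ℕ.* k ℕ.+ 3) ⊛ (oneS ⊕ X^ 1) ⊛ oddRatio)

recurrenceBase : Series
recurrenceBase = mono (ℤ.+ 2) 1 ⊕ ⊖ ((X^ 1 ⊕ X^ 2) ⊛ oddRatio)

1+X^-coeff-0 : ∀ {e} → 1 ≤ e → (oneS ⊕ X^ e) 0 ≡ 1ℤ
1+X^-coeff-0 {e} = factor-coeff-0 (- 1ℤ) e

2k+4≥1 : ∀ k → 1 ≤ 2 ℕ.* k ℕ.+ 4
2k+4≥1 k = ℕP.≤-trans (s≤s z≤n) (ℕP.m≤n+m 4 (2 ℕ.* k))

X^-2k+3-split : ∀ k → X^ (2 ℕ.* k ℕ.+ 3) ≋ X^ 1 ⊛ X^ (suc k) ⊛ X^ (suc k)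
X^-2k+3-split k = ≋-trans (≋-reflexive (cong X^_ (exponent k)))
                    (≋-trans (X^-+ (1 ℕ.+ suc k) (suc k)) (⊛-congʳ (X^ (suc k)) (X^-+ 1 (suc k))))
  where
  exponent : ∀ k → 2 ℕ.* k ℕ.+ 3 ≡ (1 ℕ.+ suc k) ℕ.+ suc k
  exponent = ℕSolver.solve-∀

X^-2k+4-split : ∀ k → X^ (2 ℕ.* k ℕ.+ 4) ≋ X^ 1 ⊛ X^ 1 ⊛ X^ (suc k) ⊛ X^ (suc k)
X^-2k+4-split k = ≋-trans (≋-reflexive (cong X^_ (exponent k)))
                    (≋-trans (X^-+ 1 (2 ℕ.* k ℕ.+ 3)) (≋-trans (⊛-congˡ (X^ 1) (X^-2k+3-split k)) (assoc³ (X^ 1) (X^ 1) (X^ (suc k)) (X^ (suc k)))))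
  where
  exponent : ∀ k → 2 ℕ.* k ℕ.+ 4 ≡ 1 ℕ.+ (2 ℕ.* k ℕ.+ 3)
  exponent = ℕSolver.solve-∀
  assoc³ : ∀ a b c d → a ⊛ (b ⊛ c ⊛ d) ≋ a ⊛ b ⊛ c ⊛ d
  assoc³ = solve 4 (λ a b c d → a :* (b :* c :* d) := a :* b :* c :* d) ≋-refl
    where open SeriesSolver

sptGF-recurrence-≈[] : ∀ k t → (oneS ⊕ X^ (2 ℕ.* k ℕ.+ 4)) ⊛ sptGF (suc (suc k)) ≈[ t ] recurrenceStep k (sptGF (suc k))
sptGF-recurrence-≈[] k t = begin
  (oneS ⊕ X^ (2 ℕ.* k ℕ.+ 4)) ⊛ sptGF (suc (suc k))
    ≈⟨ ≋⇒≈[] (⊛-congʳ (sptGF (suc (suc k))) (⊕-congˡ oneS (X^-2k+4-split k))) ⟩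
  (oneS ⊕ q ⊛ q ⊛ u ⊛ u) ⊛ sptGF (suc (suc k))
    ≈⟨ sptGF-telescoped ⟩
  (q ⊕ ⊖ (q ⊛ u ⊛ u)) ⊛ weightedSum (suc k) t a ⊕ ⊖ (q ⊛ u ⊛ u ⊛ ((oneS ⊕ q) ⊛ oddRatio)) ⊕ (edge (suc t) ⊕ edge (suc (suc t)))
    ≈⟨ ⊕-≈[] (⊕-≈[]ʳ (⊖ (q ⊛ u ⊛ u ⊛ ((oneS ⊕ q) ⊛ oddRatio)))
                     (⊛-≈[]ˡ (q ⊕ ⊖ (q ⊛ u ⊛ u)) (≈[]-sym (sptGF-≈[] (suc k) (s≤s z≤n) M t t<M ℕP.≤-refl))))
             (⊕-≈[] (edge-≈[]-0 (s≤s z≤n) (suc t) ℕP.≤-refl) (edge-≈[]-0 (s≤s z≤n) (suc (suc t)) (ℕP.n≤1+n _))) ⟩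
  (q ⊕ ⊖ (q ⊛ u ⊛ u)) ⊛ sptGF (suc k) ⊕ ⊖ (q ⊛ u ⊛ u ⊛ ((oneS ⊕ q) ⊛ oddRatio)) ⊕ (0S ⊕ 0S)
    ≈⟨ ≋⇒≈[] (≋-sym (≋-trans (⊕-cong (⊛-congʳ (sptGF (suc k)) (⊕-congˡ q (≋-trans (mono-neg _) (⊖-cong (X^-2k+3-split k)))))
                                     (⊖-cong (⊛-congʳ oddRatio (⊛-congʳ (oneS ⊕ q) (X^-2k+3-split k)))))
                             (regroup q (q ⊛ u ⊛ u) (sptGF (suc k)) oddRatio))) ⟩
  recurrenceStep k (sptGF (suc k)) ∎
  where
  open SptRecurrence (suc k) t
  open ≈[]-Reasoning t
  open SeriesSolver
  regroup : ∀ q y g p → (q ⊕ ⊖ y) ⊛ g ⊕ ⊖ (y ⊛ (oneS ⊕ q) ⊛ p) ≋ (q ⊕ ⊖ y) ⊛ g ⊕ ⊖ (y ⊛ ((oneS ⊕ q) ⊛ p)) ⊕ (0S ⊕ 0S)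
  regroup = solve 4 (λ q y g p → (q :- y) :* g :- y :* (con 1ℤ :+ q) :* p := (q :- y) :* g :- y :* ((con 1ℤ :+ q) :* p) :+ (con 0ℤ :+ con 0ℤ)) ≋-refl

sptGF-recurrence : ∀ k → (oneS ⊕ X^ (2 ℕ.* k ℕ.+ 4)) ⊛ sptGF (suc (suc k)) ≋ recurrenceStep k (sptGF (suc k))
sptGF-recurrence k = ≈[]⇒≋ (sptGF-recurrence-≈[] k)

sptGF-base-≈[] : ∀ t → (oneS ⊕ X^ 2) ⊛ sptGF 1 ≈[ t ] recurrenceBase
sptGF-base-≈[] t = begin
  (oneS ⊕ X^ 2) ⊛ sptGF 1
    ≈⟨ ≋⇒≈[] (⊛-congʳ (sptGF 1) (⊕-congˡ oneS (≋-trans (X^-+ 1 1) (padUnits q q u X^0≋1)))) ⟩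
  (oneS ⊕ q ⊛ q ⊛ u ⊛ u) ⊛ sptGF 1
    ≈⟨ sptGF-telescoped ⟩
  (q ⊕ ⊖ (q ⊛ u ⊛ u)) ⊛ weightedSum 0 t a ⊕ ⊖ (q ⊛ u ⊛ u ⊛ ((oneS ⊕ q) ⊛ oddRatio)) ⊕ (edge (suc t) ⊕ edge (suc (suc t)))
    ≈⟨ ⊕-≈[]ˡ ((q ⊕ ⊖ (q ⊛ u ⊛ u)) ⊛ weightedSum 0 t a ⊕ ⊖ (q ⊛ u ⊛ u ⊛ ((oneS ⊕ q) ⊛ oddRatio)))
              (⊕-≈[] (edge-≈[]-q refl (suc t) ℕP.≤-refl) (edge-≈[]-q refl (suc (suc t)) (ℕP.n≤1+n _))) ⟩
  (q ⊕ ⊖ (q ⊛ u ⊛ u)) ⊛ weightedSum 0 t a ⊕ ⊖ (q ⊛ u ⊛ u ⊛ ((oneS ⊕ q) ⊛ oddRatio)) ⊕ (q ⊕ q)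
    ≈⟨ ≋⇒≈[] (regroup q u (weightedSum 0 t a) oddRatio) ⟩
  q ⊛ (oneS ⊕ ⊖ (u ⊛ u)) ⊛ (weightedSum 0 t a ⊕ (oneS ⊕ q) ⊛ oddRatio) ⊕ (constS (ℤ.+ 2) ⊛ q ⊕ ⊖ ((q ⊕ q ⊛ q) ⊛ oddRatio))
    ≈⟨ ≋⇒≈[] (⊕-cong (≋-trans (⊛-congʳ (weightedSum 0 t a ⊕ (oneS ⊕ q) ⊛ oddRatio) (⊛-congˡ q (noUnit u X^0≋1)))
                               (annihilate q (weightedSum 0 t a ⊕ (oneS ⊕ q) ⊛ oddRatio)))
                      (⊕-cong (≋-sym (mono≋constS⊛X^ (ℤ.+ 2) 1)) (⊖-cong (⊛-congʳ oddRatio (⊕-congˡ q (≋-sym (X^-+ 1 1))))))) ⟩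
  0S ⊕ recurrenceBase
    ≈⟨ ≋⇒≈[] (⊕-identityˡ recurrenceBase) ⟩
  recurrenceBase ∎
  where
  open SptRecurrence 0 t
  open ≈[]-Reasoning t
  open SeriesSolver
  padUnits : ∀ x y e → e ≋ oneS → x ⊛ y ≋ x ⊛ y ⊛ e ⊛ e
  padUnits x y e e≋1 = ≋-sym (≋-trans (⊛-cong (⊛-congˡ (x ⊛ y) e≋1) e≋1) (units x y))
    where
    units : ∀ x y → x ⊛ y ⊛ oneS ⊛ oneS ≋ x ⊛ y
    units = solve 2 (λ x y → x :* y :* con 1ℤ :* con 1ℤ := x :* y) ≋-refl
  noUnit : ∀ e → e ≋ oneS → oneS ⊕ ⊖ (e ⊛ e) ≋ 0S
  noUnit e e≋1 = ≋-trans (⊕-congˡ oneS (⊖-cong (≋-trans (⊛-cong e≋1 e≋1) (⊛-identityˡ oneS)))) (cancel oneS)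
    where
    cancel : ∀ x → x ⊕ ⊖ x ≋ 0S
    cancel = solve 1 (λ x → x :- x := con 0ℤ) ≋-refl
  annihilate : ∀ q x → q ⊛ 0S ⊛ x ≋ 0S
  annihilate = solve 2 (λ q x → q :* con 0ℤ :* x := con 0ℤ) ≋-refl
  ⊕-identityˡ : ∀ x → 0S ⊕ x ≋ x
  ⊕-identityˡ = solve 1 (λ x → con 0ℤ :+ x := x) ≋-refl
  regroup : ∀ q u w p →
    (q ⊕ ⊖ (q ⊛ u ⊛ u)) ⊛ w ⊕ ⊖ (q ⊛ u ⊛ u ⊛ ((oneS ⊕ q) ⊛ p)) ⊕ (q ⊕ q)
    ≋ q ⊛ (oneS ⊕ ⊖ (u ⊛ u)) ⊛ (w ⊕ (oneS ⊕ q) ⊛ p) ⊕ (constS (ℤ.+ 2) ⊛ q ⊕ ⊖ ((q ⊕ q ⊛ q) ⊛ p))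
  regroup = solve 4 (λ q u w p →
    (q :- q :* u :* u) :* w :- q :* u :* u :* ((con 1ℤ :+ q) :* p) :+ (q :+ q)
    := q :* (con 1ℤ :- u :* u) :* (w :+ (con 1ℤ :+ q) :* p) :+ (con (ℤ.+ 2) :* q :- (q :+ q :* q) :* p)) ≋-refl

sptGF-base : (oneS ⊕ X^ 2) ⊛ sptGF 1 ≋ recurrenceBase
sptGF-base = ≈[]⇒≋ sptGF-base-≈[]

rhs-base : (oneS ⊕ X^ 2) ⊛ rhs 1 ≋ recurrenceBase
rhs-base = begin
  f ⊛ (⊖ ((X^ 1 ⊕ X^ 2) ⊛ inv f) ⊛ pochInf 1ℤ 1 ⊛ inv (pochInf (- 1ℤ) 1) ⊕ mono (ℤ.+ 2) 1 ⊛ oneS ⊛ inv (oneS ⊛ f))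
    ≈⟨ ⊛-congˡ f (⊕-congˡ (⊖ ((X^ 1 ⊕ X^ 2) ⊛ inv f) ⊛ pochInf 1ℤ 1 ⊛ inv (pochInf (- 1ℤ) 1))
                          (⊛-congˡ (mono (ℤ.+ 2) 1 ⊛ oneS) (inv-cong (⊛-identityˡ f)))) ⟩
  f ⊛ (⊖ ((X^ 1 ⊕ X^ 2) ⊛ inv f) ⊛ pochInf 1ℤ 1 ⊛ inv (pochInf (- 1ℤ) 1) ⊕ mono (ℤ.+ 2) 1 ⊛ oneS ⊛ inv f)
    ≈⟨ regroup f (inv f) (X^ 1 ⊕ X^ 2) (pochInf 1ℤ 1) (inv (pochInf (- 1ℤ) 1)) (mono (ℤ.+ 2) 1) ⟩
  f ⊛ inv f ⊛ recurrenceBase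
    ≈⟨ ⊛-congʳ recurrenceBase (⊛-inverseʳ f refl) ⟩
  oneS ⊛ recurrenceBase
    ≈⟨ ⊛-identityˡ recurrenceBase ⟩
  recurrenceBase ∎
  where
  open ≋-Reasoning
  open SeriesSolver
  f = oneS ⊕ X^ 2
  regroup : ∀ f i g p ip m → f ⊛ (⊖ (g ⊛ i) ⊛ p ⊛ ip ⊕ m ⊛ oneS ⊛ i) ≋ f ⊛ i ⊛ (m ⊕ ⊖ (g ⊛ (p ⊛ ip)))
  regroup = solve 6 (λ f i g p ip m → f :* (:- (g :* i) :* p :* ip :+ m :* con 1ℤ :* i) := f :* i :* (m :- g :* (p :* ip))) ≋-refl

module RhsRecurrence (k : ℕ) where

  F IF q Z T′ pI iI c2 Xs p ip : Series
  F = oneS ⊕ X^ (2 ℕ.* k ℕ.+ 4)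
  IF = inv F
  q = X^ 1
  Z = X^ (2 ℕ.+ 2 ℕ.* k)
  T′ = Tbar (suc k)
  pI = pochInf 1ℤ 1
  iI = inv (pochInf (- 1ℤ) 1)
  c2 = constS (ℤ.+ 2)
  Xs = X^ (suc k)
  p = poch 1ℤ 2 k
  ip = inv (poch (- 1ℤ) 2 (suc k))

  X^-2k+3-shift : X^ (2 ℕ.* k ℕ.+ 3) ≋ q ⊛ Z
  X^-2k+3-shift = ≋-trans (≋-reflexive (cong X^_ (exponent k))) (X^-+ 1 (2 ℕ.+ 2 ℕ.* k))
    where
    exponent : ∀ k → 2 ℕ.* k ℕ.+ 3 ≡ 1 ℕ.+ (2 ℕ.+ 2 ℕ.* k)
    exponent = ℕSolver.solve-∀

  step≋ : X^ 1 ⊕ mono (- 1ℤ) (2 ℕ.* k ℕ.+ 3) ≋ q ⊕ ⊖ (q ⊛ Z)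
  step≋ = ⊕-congˡ q (≋-trans (mono-neg _) (⊖-cong X^-2k+3-shift))

  inv-lastFactor : inv (poch (- 1ℤ) 2 (suc (suc k))) ≋ ip ⊛ IF
  inv-lastFactor = ≋-trans (inv-distrib-⊛ (poch (- 1ℤ) 2 (suc k)) (factor (- 1ℤ) (2 ℕ.+ 2 ℕ.* suc k))
                                          (poch-coeff-0 (- 1ℤ) 2 (suc k) (s≤s z≤n)) (factor-coeff-0 (- 1ℤ) (2 ℕ.+ 2 ℕ.* suc k) (s≤s z≤n)))
                           (⊛-congˡ ip (inv-cong (≋-reflexive (cong (λ e → oneS ⊕ X^ e) (exponent k)))))
    where
    exponent : ∀ k → 2 ℕ.+ 2 ℕ.* suc k ≡ 2 ℕ.* k ℕ.+ 4
    exponent = ℕSolver.solve-∀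

  rhs-unfold : rhs (suc (suc k)) ≋
    ((q ⊕ ⊖ (q ⊛ Z)) ⊛ T′ ⊕ ⊖ ((q ⊛ Z) ⊛ (oneS ⊕ q))) ⊛ IF ⊛ pI ⊛ iI ⊕ (c2 ⊛ (q ⊛ Xs)) ⊛ (p ⊛ (oneS ⊕ ⊖ Z)) ⊛ (ip ⊛ IF)
  rhs-unfold = ⊕-cong (⊛-congʳ iI (⊛-congʳ pI (⊛-congʳ IF (⊕-cong (⊛-congʳ T′ step≋) (⊖-cong (⊛-congʳ (oneS ⊕ q) X^-2k+3-shift))))))
                      (⊛-cong (⊛-cong (≋-trans (mono≋constS⊛X^ (ℤ.+ 2) (suc (suc k))) (⊛-congˡ c2 (X^-suc (suc k))))
                                      (⊛-congˡ p (factor≋ (2 ℕ.+ 2 ℕ.* k))))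
                              inv-lastFactor)

  -- q (1 - q^{2k+2}) = q - q^{2k+3} turns the second summand into the same multiple as the first.
  rhs-recurrence : F ⊛ rhs (suc (suc k)) ≋ recurrenceStep k (rhs (suc k))
  rhs-recurrence = begin
    F ⊛ rhs (suc (suc k))
      ≈⟨ ⊛-congˡ F rhs-unfold ⟩
    F ⊛ (((q ⊕ ⊖ (q ⊛ Z)) ⊛ T′ ⊕ ⊖ ((q ⊛ Z) ⊛ (oneS ⊕ q))) ⊛ IF ⊛ pI ⊛ iI ⊕ (c2 ⊛ (q ⊛ Xs)) ⊛ (p ⊛ (oneS ⊕ ⊖ Z)) ⊛ (ip ⊛ IF))
      ≈⟨ regroup F IF q Z T′ pI iI c2 Xs p ip ⟩
    F ⊛ IF ⊛ R
      ≈⟨ ⊛-congʳ R (⊛-inverseʳ F (1+X^-coeff-0 (2k+4≥1 k))) ⟩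
    oneS ⊛ R
      ≈⟨ ⊛-identityˡ R ⟩
    R
      ≈⟨ ⊕-cong (⊛-cong step≋ (⊕-congˡ (T′ ⊛ pI ⊛ iI) (⊛-congʳ ip (⊛-congʳ p (mono≋constS⊛X^ (ℤ.+ 2) (suc k))))))
                (⊖-cong (⊛-congʳ (pI ⊛ iI) (⊛-congʳ (oneS ⊕ q) X^-2k+3-shift))) ⟨
    recurrenceStep k (rhs (suc k)) ∎
    where
    open ≋-Reasoning
    open SeriesSolver
    R = (q ⊕ ⊖ (q ⊛ Z)) ⊛ (T′ ⊛ pI ⊛ iI ⊕ c2 ⊛ Xs ⊛ p ⊛ ip) ⊕ ⊖ ((q ⊛ Z) ⊛ (oneS ⊕ q) ⊛ (pI ⊛ iI))
    regroup : ∀ F IF q Z T′ pI iI c2 Xs p ip →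
      F ⊛ (((q ⊕ ⊖ (q ⊛ Z)) ⊛ T′ ⊕ ⊖ ((q ⊛ Z) ⊛ (oneS ⊕ q))) ⊛ IF ⊛ pI ⊛ iI ⊕ (c2 ⊛ (q ⊛ Xs)) ⊛ (p ⊛ (oneS ⊕ ⊖ Z)) ⊛ (ip ⊛ IF))
      ≋ F ⊛ IF ⊛ ((q ⊕ ⊖ (q ⊛ Z)) ⊛ (T′ ⊛ pI ⊛ iI ⊕ c2 ⊛ Xs ⊛ p ⊛ ip) ⊕ ⊖ ((q ⊛ Z) ⊛ (oneS ⊕ q) ⊛ (pI ⊛ iI)))
    regroup = solve 11 (λ F IF q Z T′ pI iI c2 Xs p ip →
      F :* (((q :- q :* Z) :* T′ :- (q :* Z) :* (con 1ℤ :+ q)) :* IF :* pI :* iI :+ (c2 :* (q :* Xs)) :* (p :* (con 1ℤ :- Z)) :* (ip :* IF))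
      := F :* IF :* ((q :- q :* Z) :* (T′ :* pI :* iI :+ c2 :* Xs :* p :* ip) :- (q :* Z) :* (con 1ℤ :+ q) :* (pI :* iI))) ≋-refl

recurrenceStep-cong : ∀ k {g h} → g ≋ h → recurrenceStep k g ≋ recurrenceStep k h
recurrenceStep-cong k g≋h = ⊕-congʳ _ (⊛-congˡ (X^ 1 ⊕ mono (- 1ℤ) (2 ℕ.* k ℕ.+ 3)) g≋h)

sptGF≋rhs : ∀ k → sptGF (suc k) ≋ rhs (suc k)
sptGF≋rhs zero = ≋-trans (f⊛g≋h⇒g≋f⁻¹⊛h (oneS ⊕ X^ 2) refl sptGF-base) (≋-sym (f⊛g≋h⇒g≋f⁻¹⊛h (oneS ⊕ X^ 2) refl rhs-base))
sptGF≋rhs (suc k) = begin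
  sptGF (suc (suc k))                      ≈⟨ f⊛g≋h⇒g≋f⁻¹⊛h F F₀≡1 (sptGF-recurrence k) ⟩
  inv F ⊛ recurrenceStep k (sptGF (suc k)) ≈⟨ ⊛-congˡ (inv F) (recurrenceStep-cong k (sptGF≋rhs k)) ⟩
  inv F ⊛ recurrenceStep k (rhs (suc k))   ≈⟨ f⊛g≋h⇒g≋f⁻¹⊛h F F₀≡1 (RhsRecurrence.rhs-recurrence k) ⟨
  rhs (suc (suc k))                        ∎
  where
  open ≋-Reasoning
  F = oneS ⊕ X^ (2 ℕ.* k ℕ.+ 4)
  F₀≡1 : F 0 ≡ 1ℤ
  F₀≡1 = 1+X^-coeff-0 (2k+4≥1 k)

theorem2p6 : (k : ℕ) → 1 ≤ k → (n : ℕ) → sptGF k n ≡ rhs k n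
theorem2p6 (suc k) _ = coeff (sptGF≋rhs k)
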